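{- Let $n\ge 1$ and let $\pi\in S_n$ be a permutation with pinnacle set $S$, where $|S|=p$. Then there is a sequence $R$ of reversals, each of which is balanced for the permutation to which it is applied, transforming $\pi$ into the canonical permutation $\mathit{Id}_S\in S_n$. If $p\ge 1$, $R$ consists of at most $2n-\min\{p,3\}$ balanced reversals; if $p=0$, $R$ consists of at most $2n-1$ balanced reversals.
   Context: Convention: a permutation $\pi=(\pi_1\,\pi_2\,\ldots\,\pi_n)\in S_n$ is always extended by $\pi_0=n+1$ and $\pi_{n+1}=n+2$. A pinnacle of $\pi$ is an element $\pi_i$ with $1\le i\le n$ and $\pi_{i-1}<\pi_i>\pi_{i+1}$; the pinnacle set of $\pi$ is the set of its pinnacles. For elements $w_1=\pi_a$, $w_2=\pi_b$ with $1\le a\le b\le n$, the reversal $\rho(w_1,w_2)$ transforms $\pi=(\pi_0\ldots\pi_{a-1}\,\pi_a\ldots\pi_b\,\pi_{b+1}\ldots\pi_{n+1})$ into $\pi\cdot\rho(w_1,w_2)=(\pi_0\ldots\pi_{a-1}\,\pi_b\,\pi_{b-1}\ldots\pi_a\,\pi_{b+1}\ldots\pi_{n+1})$. The reversal $\rho(w_1,w_2)$ is balanced for $\pi$ if $\pi$ and $\pi\cdot\rho(w_1,w_2)$ have the same pinnacle set. Canonical permutation: for $S=\{s_1<s_2<\ldots<s_d\}\subseteq\{1,\ldots,n\}$ with $n>2d$, $\mathit{Id}_S\in S_n$ is obtained by placing the elements of $S$ in increasing order at positions $2,4,\ldots,2d$ and the elements of $\{1,\ldots,n\}\setminus S$ in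 increasing order at positions $1,3,\ldots,2d-1,2d+1,2d+2,\ldots,n$ (and, by the convention, $n+1$ and $n+2$ are added at the beginning and end). -}

module Defs where

open import Data.Nat using (ℕ; zero; suc; _+_; _*_; _∸_; _<_; _≤_; _⊓_)
open import Data.Nat.Properties using (_≟_)
open import Data.List using (List; []; _∷_; _++_; [_]; length; take; drop; reverse; map; upTo; filter)
open import Data.List.Membership.DecPropositional _≟_ using (_∈?_)
open import Data.Product using (Σ; ∃; _×_; _,_)
open import Function.Bundles using (_⇔_)
open import Relation.Nullary using (¬?)
open import Relation.Binary.PropositionalEquality using (_≡_)

-- A permutation π ∈ S_n is represented by the list (π_1 … π_n) of its values.
-- The list [1, 2, …, n]:
range : ℕ → List ℕ
range n = map suc (upTo n)

-- Extension by the convention π_0 = n+1, π_{n+1} = n+2 (n = length π).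
ext : List ℕ → List ℕ
ext π = suc (length π) ∷ π ++ [ suc (suc (length π)) ]

-- Since π_0 = n+1 and π_{n+1} = n+2 are the two ends, such an
-- occurrence is automatically at a position 1 ≤ i ≤ n.
IsPinnacle : List ℕ → ℕ → Set
IsPinnacle π v = Σ (List ℕ) λ xs → Σ (List ℕ) λ ys → Σ ℕ λ a → Σ ℕ λ c →
  (ext π ≡ xs ++ a ∷ v ∷ c ∷ ys) × (a < v) × (c < v)

-- Reversal of the segment between positions a and b (1-based, 1 ≤ a ≤ b ≤ n):
-- (π_1 … π_{a-1} π_b π_{b-1} … π_a π_{b+1} … π_n).
-- (Since π has distinct entries, ρ(π_a, π_b) is determined by the positions a, b.)
rev : ℕ → ℕ → List ℕ → List ℕ
rev a b π = take (a ∸ 1) π ++ reverse (take (b ∸ (a ∸ 1)) (drop (a ∸ 1) π)) ++ drop b π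

Balanced : List ℕ → ℕ → ℕ → Set
Balanced π a b = ∀ v → IsPinnacle π v ⇔ IsPinnacle (rev a b π) v

data Reaches : List ℕ → List (ℕ × ℕ) → List ℕ → Set where
  done : ∀ {π} → Reaches π [] π
  step : ∀ {π a b R σ} → 1 ≤ a → a ≤ b → b ≤ length π →
         Balanced π a b → Reaches (rev a b π) R σ → Reaches π ((a , b) ∷ R) σ

interleave : List ℕ → List ℕ → List ℕ
interleave (c ∷ cs) (s ∷ ss) = c ∷ s ∷ interleave cs ss
interleave cs       []       = cs
interleave []       ss       = ss

-- Canonical permutation Id_S ∈ S_n, for S given as an increasing list.
canonical : ℕ → List ℕ → List ℕ
canonical n S = interleave (filter (λ v → ¬? (v ∈? S)) (range n)) S

-- A reversal changes only the two adjacencies at the ends of the reversed segment, so to see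
-- that it is balanced one only compares the four letters around those ends.  Let m be the largest non-pinnacle; at most two balanced
-- reversals move m to the end.  If the letter before m is then smaller, m is split off and the
-- rest is sorted recursively.  Otherwise that letter is a pinnacle, and either two non-pinnacles
-- are adjacent, so that one reversal brings the second of them in front of m, or there are at
-- most |S| + 1 non-pinnacles, and one reversal brings the largest pinnacle p in front of m, so
-- that p m is split off.  Every split letter costs at most two reversals and every split
-- pinnacle one less, which gives at most 2n − |S| − 2 reversals, below both stated bounds.

module Submission where

open import Defs
open import Data.Empty using (⊥-elim)
open import Data.List using (List; []; _∷_; _++_; [_]; length; take; drop; reverse; filter; map; upTo)
open import Data.List.Properties
  using (++-assoc; ++-identityʳ; unfold-reverse; reverse-++; reverse-involutive; length-++; length-++-sucʳ;
         length-reverse; length-map; length-upTo; ∷-injective)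
open import Data.List.Reverse using (reverseView; []; _∶_∶ʳ_)
open import Data.List.Membership.Propositional using (_∈_; _∉_)
open import Data.List.Membership.Propositional.Properties
  using (∈-++⁺ˡ; ∈-++⁺ʳ; ∈-++⁻; ∈-∃++; ∈-filter⁺; ∈-filter⁻; ∈-map⁻; ∈-upTo⁻)
open import Data.List.Membership.Propositional.Properties.WithK using (unique∧set⇒bag)
open import Data.List.Relation.Unary.Any using (here; there)
open import Data.List.Relation.Unary.All using (All; []; _∷_; lookup; tabulate)
open import Data.List.Relation.Unary.AllPairs using (AllPairs; []; _∷_)
import Data.List.Relation.Unary.AllPairs as AllPairs
import Data.List.Relation.Unary.AllPairs.Properties as AllPairs
open import Data.List.Relation.Unary.Unique.Propositional using (Unique)
import Data.List.Relation.Unary.Unique.Propositional.Properties as Unique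
open import Data.List.Relation.Binary.Disjoint.Propositional using (Disjoint)
open import Data.List.Relation.Binary.BagAndSetEquality using (∼bag⇒↭)
open import Data.List.Relation.Binary.Permutation.Propositional using (_↭_; ↭-refl; ↭-sym; ↭-trans; ↭⇒↭ₛ)
open import Data.List.Relation.Binary.Permutation.Propositional.Properties using (∈-resp-↭; zoom; ↭-reverse; ↭-length)
import Data.List.Relation.Binary.Permutation.Setoid.Properties as Permutationₛ
open import Data.Nat using (ℕ; zero; suc; _+_; _*_; _∸_; _<_; _≤_; _⊓_; z≤n; s≤s)
open import Data.Nat.Properties
open import Data.List.Membership.DecPropositional _≟_ using (_∈?_)
open import Data.Product using (Σ; ∃; ∃₂; _×_; _,_; proj₁; proj₂)
open import Data.Product.Function.NonDependent.Propositional using (_×-⇔_)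
open import Data.Sum using (_⊎_; inj₁; inj₂)
open import Data.Sum.Function.Propositional using (_⊎-⇔_)
open import Data.Unit using (⊤; tt)
open import Function.Bundles using (_⇔_; mk⇔; Equivalence)
open import Function.Construct.Composition using (_⇔-∘_)
open import Function.Construct.Identity using (⇔-id)
open import Function.Construct.Symmetry using (⇔-sym)
open import Relation.Binary.Definitions using (tri<; tri≈; tri>)
open import Relation.Binary.PropositionalEquality
  using (_≡_; _≢_; refl; sym; trans; cong; cong₂; subst; subst₂; setoid;
         module ≡-Reasoning)
open import Relation.Nullary using (¬_; ¬?; Dec; yes; no)

module _ {A : Set} where

  lastOr : A → List A → A
  lastOr d []       = d
  lastOr d (a ∷ as) = lastOr a as

  initOr : A → List A → List A
  initOr d []       = []
  initOr d (a ∷ as) = d ∷ initOr a as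

  headOr : A → List A → A
  headOr d []      = d
  headOr d (b ∷ _) = b

  ∷-initOr-lastOr : ∀ d as → d ∷ as ≡ initOr d as ++ [ lastOr d as ]
  ∷-initOr-lastOr d []       = refl
  ∷-initOr-lastOr d (a ∷ as) = cong (d ∷_) (∷-initOr-lastOr a as)

  lastOr-∷ʳ : ∀ d xs (u : A) → lastOr d (xs ++ [ u ]) ≡ u
  lastOr-∷ʳ d []       u = refl
  lastOr-∷ʳ d (x ∷ xs) u = lastOr-∷ʳ x xs u

  lastOr-∈ : ∀ a as → lastOr a as ∈ a ∷ as
  lastOr-∈ a []       = here refl
  lastOr-∈ a (b ∷ bs) = there (lastOr-∈ b bs)

  ∈⇒1≤length : ∀ {v} {xs : List A} → v ∈ xs → 1 ≤ length xs
  ∈⇒1≤length (here _)  = s≤s z≤n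
  ∈⇒1≤length (there _) = s≤s z≤n

  ∷ʳ-view : ∀ (τ : List A) → 1 ≤ length τ → ∃₂ λ ρ r → τ ≡ ρ ++ [ r ]
  ∷ʳ-view (a ∷ as) _ = initOr a as , lastOr a as , ∷-initOr-lastOr a as

  take-length-++ : ∀ (xs ys : List A) → take (length xs) (xs ++ ys) ≡ xs
  take-length-++ []       ys = refl
  take-length-++ (x ∷ xs) ys = cong (x ∷_) (take-length-++ xs ys)

  drop-length-++ : ∀ (xs ys : List A) → drop (length xs) (xs ++ ys) ≡ ys
  drop-length-++ []       ys = refl
  drop-length-++ (x ∷ xs) ys = drop-length-++ xs ys

  length-∷ʳ : ∀ (xs : List A) y → length (xs ++ [ y ]) ≡ suc (length xs)
  length-∷ʳ []       y = refl
  length-∷ʳ (_ ∷ xs) y = cong suc (length-∷ʳ xs y)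

  1≤length-∷ʳ : ∀ (xs : List A) y → 1 ≤ length (xs ++ [ y ])
  1≤length-∷ʳ xs y = subst (1 ≤_) (sym (length-∷ʳ xs y)) (s≤s z≤n)

  drop-length-++-++ : ∀ (xs ys zs : List A) → drop (length xs + length ys) (xs ++ ys ++ zs) ≡ zs
  drop-length-++-++ []       ys zs = drop-length-++ ys zs
  drop-length-++-++ (x ∷ xs) ys zs = drop-length-++-++ xs ys zs

  reverse-∷-∷ʳ : ∀ (a : A) K b → reverse (a ∷ K ++ [ b ]) ≡ b ∷ reverse K ++ [ a ]
  reverse-∷-∷ʳ a K b = trans (unfold-reverse a (K ++ [ b ])) (cong (_++ [ a ]) (reverse-++ K [ b ]))

  data Adjacent : List A → A → A → Set where
    front  : ∀ {x y r} → Adjacent (x ∷ y ∷ r) x y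
    front˘ : ∀ {x y r} → Adjacent (x ∷ y ∷ r) y x
    later  : ∀ {x r u v} → Adjacent r u v → Adjacent (x ∷ r) u v

  data Edge (x y : A) : A → A → Set where
    fwd : Edge x y x y
    bwd : Edge x y y x

  adjacent-sym : ∀ {w u v} → Adjacent w u v → Adjacent w v u
  adjacent-sym front     = front˘
  adjacent-sym front˘    = front
  adjacent-sym (later a) = later (adjacent-sym a)

  adjacent-∈ : ∀ {w u v} → Adjacent w u v → u ∈ w
  adjacent-∈ front     = here refl
  adjacent-∈ front˘    = there (here refl)
  adjacent-∈ (later a) = there (adjacent-∈ a)

  adjacent-++ˡ : ∀ {xs} ys {u v} → Adjacent xs u v → Adjacent (xs ++ ys) u v
  adjacent-++ˡ ys front     = front
  adjacent-++ˡ ys front˘    = front˘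
  adjacent-++ˡ ys (later a) = later (adjacent-++ˡ ys a)

  adjacent-++ʳ : ∀ xs {ys u v} → Adjacent ys u v → Adjacent (xs ++ ys) u v
  adjacent-++ʳ []       a = a
  adjacent-++ʳ (x ∷ xs) a = later (adjacent-++ʳ xs a)

  adjacent-∷ : ∀ {x y r u v} → Adjacent (x ∷ y ∷ r) u v → Edge x y u v ⊎ Adjacent (y ∷ r) u v
  adjacent-∷ front     = inj₁ fwd
  adjacent-∷ front˘    = inj₁ bwd
  adjacent-∷ (later a) = inj₂ a

  adjacent-split : ∀ xs z ys {u v} → Adjacent (xs ++ z ∷ ys) u v →
                   Adjacent (xs ++ [ z ]) u v ⊎ Adjacent (z ∷ ys) u v
  adjacent-split []           z ys a         = inj₂ a
  adjacent-split (x ∷ [])     z ys front     = inj₁ front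
  adjacent-split (x ∷ [])     z ys front˘    = inj₁ front˘
  adjacent-split (x ∷ [])     z ys (later a) = inj₂ a
  adjacent-split (x ∷ x′ ∷ xs) z ys front     = inj₁ front
  adjacent-split (x ∷ x′ ∷ xs) z ys front˘    = inj₁ front˘
  adjacent-split (x ∷ x′ ∷ xs) z ys (later a) with adjacent-split (x′ ∷ xs) z ys a
  ... | inj₁ b = inj₁ (later b)
  ... | inj₂ b = inj₂ b

  adjacent-reverse⁺ : ∀ {xs u v} → Adjacent xs u v → Adjacent (reverse xs) u v
  adjacent-reverse⁺ {x ∷ y ∷ r} front
    rewrite unfold-reverse x (y ∷ r) | unfold-reverse y r | ++-assoc (reverse r) [ y ] [ x ]
    = adjacent-++ʳ (reverse r) front˘
  adjacent-reverse⁺ {x ∷ y ∷ r} front˘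
    rewrite unfold-reverse x (y ∷ r) | unfold-reverse y r | ++-assoc (reverse r) [ y ] [ x ]
    = adjacent-++ʳ (reverse r) front
  adjacent-reverse⁺ {x ∷ r} (later a)
    rewrite unfold-reverse x r = adjacent-++ˡ [ x ] (adjacent-reverse⁺ a)

  adjacent-∷ʳ-++ : ∀ xs {z} ys {u v} → Adjacent (xs ++ [ z ]) u v → Adjacent (xs ++ z ∷ ys) u v
  adjacent-∷ʳ-++ xs {z} ys a = subst (λ w → Adjacent w _ _) (++-assoc xs [ z ] ys) (adjacent-++ˡ ys a)

  adjacent-segments : ∀ P x a K b y Q {u v} → Adjacent (P ++ x ∷ a ∷ K ++ b ∷ y ∷ Q) u v →
    Adjacent (P ++ [ x ]) u v ⊎ Edge x a u v ⊎ Adjacent (a ∷ K ++ [ b ]) u v ⊎ Edge b y u v ⊎ Adjacent (y ∷ Q) u v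
  adjacent-segments P x a K b y Q adj with adjacent-split P x (a ∷ K ++ b ∷ y ∷ Q) adj
  ... | inj₁ p = inj₁ p
  ... | inj₂ xs with adjacent-∷ xs
  ... | inj₁ e = inj₂ (inj₁ e)
  ... | inj₂ as with adjacent-split (a ∷ K) b (y ∷ Q) as
  ... | inj₁ m = inj₂ (inj₂ (inj₁ m))
  ... | inj₂ bs with adjacent-∷ bs
  ... | inj₁ e = inj₂ (inj₂ (inj₂ (inj₁ e)))
  ... | inj₂ q = inj₂ (inj₂ (inj₂ (inj₂ q)))

LocalMax : List ℕ → ℕ → Set
LocalMax w v = ∀ u → Adjacent w v u → u < v

localMax-reverse : ∀ P x m₁ K mₖ y Q {v} →
  (∀ {u} → Edge x mₖ v u ⊎ Edge m₁ y v u → LocalMax (P ++ x ∷ m₁ ∷ K ++ mₖ ∷ y ∷ Q) v → u < v) →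
  LocalMax (P ++ x ∷ m₁ ∷ K ++ mₖ ∷ y ∷ Q) v → LocalMax (P ++ x ∷ mₖ ∷ reverse K ++ m₁ ∷ y ∷ Q) v
localMax-reverse P x m₁ K mₖ y Q new-edges lm u adj
  with adjacent-segments P x mₖ (reverse K) m₁ y Q adj
... | inj₁ p                         = lm u (adjacent-∷ʳ-++ P _ p)
... | inj₂ (inj₁ e)                  = new-edges (inj₁ e) lm
... | inj₂ (inj₂ (inj₁ m))           = lm u (adjacent-++ʳ P (later (adjacent-∷ʳ-++ (m₁ ∷ K) (y ∷ Q) segment)))
  where
  segment : Adjacent (m₁ ∷ K ++ [ mₖ ]) _ u
  segment = subst (λ w → Adjacent w _ _)
              (trans (reverse-∷-∷ʳ mₖ (reverse K) m₁) (cong (λ K′ → m₁ ∷ K′ ++ [ mₖ ]) (reverse-involutive K)))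
              (adjacent-reverse⁺ m)
... | inj₂ (inj₂ (inj₂ (inj₁ e)))    = new-edges (inj₂ e) lm
... | inj₂ (inj₂ (inj₂ (inj₂ q)))    = lm u (adjacent-++ʳ P (later (later (adjacent-++ʳ K (later q)))))

-- Reversing m₁ … mₖ between x and y only trades the edges x–m₁, mₖ–y for x–mₖ, m₁–y.
localMax-reverse⇔ : ∀ P x m₁ K mₖ y Q {v} →
  (∀ {u} → Edge x mₖ v u ⊎ Edge m₁ y v u → LocalMax (P ++ x ∷ m₁ ∷ K ++ mₖ ∷ y ∷ Q) v → u < v) →
  (∀ {u} → Edge x m₁ v u ⊎ Edge mₖ y v u → LocalMax (P ++ x ∷ mₖ ∷ reverse K ++ m₁ ∷ y ∷ Q) v → u < v) →
  LocalMax (P ++ x ∷ m₁ ∷ K ++ mₖ ∷ y ∷ Q) v ⇔ LocalMax (P ++ x ∷ mₖ ∷ reverse K ++ m₁ ∷ y ∷ Q) v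
localMax-reverse⇔ P x m₁ K mₖ y Q new-edges old-edges = mk⇔
  (localMax-reverse P x m₁ K mₖ y Q new-edges)
  (λ lm → subst (λ K′ → LocalMax (P ++ x ∷ m₁ ∷ K′ ++ mₖ ∷ y ∷ Q) _) (reverse-involutive K)
            (localMax-reverse P x mₖ (reverse K) m₁ y Q old-edges lm))

Unique-resp-↭ : ∀ {xs ys : List ℕ} → xs ↭ ys → Unique xs → Unique ys
Unique-resp-↭ p = Permutationₛ.Unique-resp-↭ (setoid ℕ) (↭⇒↭ₛ p)

AllPairs-++⁻ : ∀ {_∼_ : ℕ → ℕ → Set} xs ys → AllPairs _∼_ (xs ++ ys) →
               AllPairs _∼_ xs × AllPairs _∼_ ys × (∀ {x y} → x ∈ xs → y ∈ ys → x ∼ y)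
AllPairs-++⁻ []       ys p       = [] , p , λ ()
AllPairs-++⁻ {_∼_} (x ∷ xs) ys (x∼ ∷ p) with AllPairs-++⁻ xs ys p
... | pxs , pys , across = prefix xs x∼ ∷ pxs , pys , λ { (here refl) → suffix xs x∼ ; (there i) → across i }
  where
  prefix : ∀ zs → All (x ∼_) (zs ++ ys) → All (x ∼_) zs
  prefix []       _        = []
  prefix (z ∷ zs) (q ∷ qs) = q ∷ prefix zs qs
  suffix : ∀ zs → All (x ∼_) (zs ++ ys) → ∀ {y} → y ∈ ys → x ∼ y
  suffix []       q        = lookup q
  suffix (z ∷ zs) (_ ∷ qs) = suffix zs qs

Unique-++⁻ : ∀ xs ys → Unique (xs ++ ys) → Unique xs × Unique ys × Disjoint xs ys
Unique-++⁻ xs ys u with AllPairs-++⁻ xs ys u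
... | uxs , uys , across = uxs , uys , λ (i , j) → across i j refl

length-unique-≡ : ∀ {xs ys : List ℕ} → Unique xs → Unique ys → (∀ {v} → v ∈ xs → v ∈ ys) → (∀ {v} → v ∈ ys → v ∈ xs) →
                  length xs ≡ length ys
length-unique-≡ ux uy f g = ↭-length (∼bag⇒↭ (unique∧set⇒bag ux uy (mk⇔ f g)))

private
  second-after : ∀ xs {a v : ℕ} ys → v ∈ xs ++ a ∷ v ∷ ys
  second-after xs ys = ∈-++⁺ʳ xs (there (here refl))

neighbours-unique : ∀ xs a v c ys → Unique (xs ++ a ∷ v ∷ c ∷ ys) →
                    ∀ {u} → Adjacent (xs ++ a ∷ v ∷ c ∷ ys) v u → u ≡ a ⊎ u ≡ c
neighbours-unique [] a v c ys ((a≢v ∷ _) ∷ _) front               = ⊥-elim (a≢v refl)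
neighbours-unique [] a v c ys _               front˘              = inj₁ refl
neighbours-unique [] a v c ys _               (later front)       = inj₂ refl
neighbours-unique [] a v c ys (_ ∷ (v≢c ∷ _) ∷ _) (later front˘)  = ⊥-elim (v≢c refl)
neighbours-unique [] a v c ys (_ ∷ v∉ ∷ _)   (later (later b)) = ⊥-elim (lookup v∉ (adjacent-∈ b) refl)
neighbours-unique (x ∷ [])      a v c ys ((_ ∷ x≢v ∷ _) ∷ _)     front  = ⊥-elim (x≢v refl)
neighbours-unique (x ∷ x′ ∷ xs) a v c ys (x∉ ∷ _)              front  = ⊥-elim (lookup x∉ (there (second-after xs (c ∷ ys))) refl)
neighbours-unique (x ∷ [])      a v c ys (_ ∷ (a≢v ∷ _) ∷ _)     front˘ = ⊥-elim (a≢v refl)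
neighbours-unique (x ∷ x′ ∷ xs) a v c ys (_ ∷ x′∉ ∷ _)          front˘ = ⊥-elim (lookup x′∉ (second-after xs (c ∷ ys)) refl)
neighbours-unique (x ∷ xs) a v c ys (_ ∷ u) (later b) = neighbours-unique xs a v c ys u b

interleave-∷ʳ : ∀ (C S : List ℕ) m → length S ≤ length C → interleave (C ++ [ m ]) S ≡ interleave C S ++ [ m ]
interleave-∷ʳ []      []      m _       = refl
interleave-∷ʳ (c ∷ C) []      m _       = refl
interleave-∷ʳ (c ∷ C) (s ∷ S) m (s≤s l) = cong (λ z → c ∷ s ∷ z) (interleave-∷ʳ C S m l)

interleave-∷ʳ-∷ʳ : ∀ (C S : List ℕ) p m → length C ≡ suc (length S) →
                   interleave (C ++ [ m ]) (S ++ [ p ]) ≡ interleave C S ++ p ∷ m ∷ []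
interleave-∷ʳ-∷ʳ (c ∷ [])      []      p m _  = refl
interleave-∷ʳ-∷ʳ (c ∷ c′ ∷ C)  (s ∷ S) p m eq = cong (λ z → c ∷ s ∷ z) (interleave-∷ʳ-∷ʳ (c′ ∷ C) S p m (suc-injective eq))

interleave-ends-in-S : ∀ (C S : List ℕ) → length C ≤ length S → 1 ≤ length S →
                       ∃₂ λ σ s → interleave C S ≡ σ ++ [ s ] × s ∈ S
interleave-ends-in-S []      (s ∷ [])      _ _ = [] , s , refl , here refl
interleave-ends-in-S []      (s ∷ s′ ∷ S)  _ _ with interleave-ends-in-S [] (s′ ∷ S) z≤n (s≤s z≤n)
... | σ , t , eq , t∈ = s ∷ σ , t , cong (s ∷_) eq , there t∈
interleave-ends-in-S (c ∷ []) (s ∷ []) _ _ = c ∷ [] , s , refl , here refl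
interleave-ends-in-S (c ∷ C) (s ∷ s′ ∷ S) (s≤s l) _ with interleave-ends-in-S C (s′ ∷ S) l (s≤s z≤n)
... | σ , t , eq , t∈ = c ∷ s ∷ σ , t , cong (λ z → c ∷ s ∷ z) eq , there t∈

module _ (C : List ℕ) where

  NoConsecutive : List ℕ → Set
  NoConsecutive (x ∷ y ∷ r) = ¬ (x ∈ C × y ∈ C) × NoConsecutive (y ∷ r)
  NoConsecutive _           = ⊤

  consecutive-or-none : ∀ τ → (∃₂ λ X Y → ∃₂ λ u w → τ ≡ X ++ u ∷ w ∷ Y × u ∈ C × w ∈ C) ⊎ NoConsecutive τ
  consecutive-or-none []      = inj₂ tt
  consecutive-or-none (x ∷ []) = inj₂ tt
  consecutive-or-none (x ∷ y ∷ r) with x ∈? C | y ∈? C | consecutive-or-none (y ∷ r)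
  ... | yes x∈ | yes y∈ | _ = inj₁ ([] , r , x , y , refl , x∈ , y∈)
  ... | _ | _ | inj₁ (X , Y , u , w , eq , u∈ , w∈) = inj₁ (x ∷ X , Y , u , w , cong (x ∷_) eq , u∈ , w∈)
  ... | yes x∈ | no y∉ | inj₂ none = inj₂ ((λ (_ , y∈) → y∉ y∈) , none)
  ... | no x∉  | _     | inj₂ none = inj₂ ((λ (x∈ , _) → x∉ x∈) , none)

  NoConsecutive-++-∷-∷ : ∀ τ {y} m → y ∉ C → NoConsecutive τ → NoConsecutive (τ ++ y ∷ m ∷ [])
  NoConsecutive-++-∷-∷ []           m y∉ _          = (λ (y∈ , _) → y∉ y∈) , tt
  NoConsecutive-++-∷-∷ (x ∷ [])     m y∉ _          = (λ (_ , y∈) → y∉ y∈) , (λ (y∈ , _) → y∉ y∈) , tt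
  NoConsecutive-++-∷-∷ (x ∷ x′ ∷ τ) m y∉ (n , none) = n , NoConsecutive-++-∷-∷ (x′ ∷ τ) m y∉ none

  private
    in? : ∀ v → Dec (v ∈ C)
    in? v = v ∈? C
    out? : ∀ v → Dec (v ∉ C)
    out? v = ¬? (v ∈? C)

    StartsOutside : List ℕ → Set
    StartsOutside []      = ⊤
    StartsOutside (x ∷ _) = x ∉ C

    NoConsecutive-tail : ∀ x r → NoConsecutive (x ∷ r) → NoConsecutive r
    NoConsecutive-tail x []      _        = tt
    NoConsecutive-tail x (y ∷ r) (_ , n) = n

    filter-balance : ∀ π → NoConsecutive π →
      length (filter in? π) ≤ suc (length (filter out? π)) ×
      (StartsOutside π → length (filter in? π) ≤ length (filter out? π))
    filter-balance []      _ = z≤n , λ _ → z≤n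
    filter-balance (x ∷ r) n with x ∈? C | filter-balance r (NoConsecutive-tail x r n)
    ... | yes x∈ | _ , outside = s≤s (outside (next-outside r n)) , λ x∉ → ⊥-elim (x∉ x∈)
      where
      next-outside : ∀ r → NoConsecutive (x ∷ r) → StartsOutside r
      next-outside []      _       = tt
      next-outside (y ∷ r) (n , _) = λ y∈ → n (x∈ , y∈)
    ... | no _   | balance , _ = m≤n⇒m≤1+n balance , λ _ → balance

  NoConsecutive⇒length≤ : ∀ π (S : List ℕ) → NoConsecutive π → Unique π → Unique C → Unique S →
    (∀ {v} → v ∈ C → v ∈ π) → (∀ {v} → v ∈ S → v ∈ π) → (∀ {v} → v ∈ π → v ∉ C → v ∈ S) → (∀ {v} → v ∈ S → v ∉ C) →
    length C ≤ suc (length S)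
  NoConsecutive⇒length≤ π S n uπ uC uS C⊆π S⊆π π⊆C∪S S∩C =
    subst₂ (λ a b → a ≤ suc b) (sym |C|) (sym |S|) (proj₁ (filter-balance π n))
    where
    |C| : length C ≡ length (filter in? π)
    |C| = length-unique-≡ uC (Unique.filter⁺ in? uπ) (λ i → ∈-filter⁺ in? (C⊆π i) i) (λ i → proj₂ (∈-filter⁻ in? {xs = π} i))
    |S| : length S ≡ length (filter out? π)
    |S| = length-unique-≡ uS (Unique.filter⁺ out? uπ) (λ i → ∈-filter⁺ out? (S⊆π i) (S∩C i))
            (λ i → let (j , j∉) = ∈-filter⁻ out? {xs = π} i in π⊆C∪S j j∉)

-- The sentinels L and R stay fixed while the recursion shortens the word, whereas ext recomputes them.
module Sentinels (L R : ℕ) where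

  W : List ℕ → List ℕ
  W π = L ∷ π ++ [ R ]

  Pinnacle : List ℕ → ℕ → Set
  Pinnacle π v = v ∈ π × LocalMax (W π) v

  SamePinnacles : List ℕ → List ℕ → Set
  SamePinnacles π π′ = ∀ v → Pinnacle π v ⇔ Pinnacle π′ v

  data Reversals : List ℕ → List (ℕ × ℕ) → List ℕ → Set where
    done : ∀ {π} → Reversals π [] π
    step : ∀ {Rs σ} A M B → 1 ≤ length M →
           SamePinnacles (A ++ M ++ B) (A ++ reverse M ++ B) → Reversals (A ++ reverse M ++ B) Rs σ →
           Reversals (A ++ M ++ B) ((suc (length A) , length A + length M) ∷ Rs) σ

  tailW : List ℕ → List ℕ
  tailW []       = []
  tailW (_ ∷ bs) = bs ++ [ R ]

  ∷ʳ-headOr : ∀ B → B ++ [ R ] ≡ headOr R B ∷ tailW B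
  ∷ʳ-headOr []      = refl
  ∷ʳ-headOr (_ ∷ _) = refl

  W-split : ∀ A M B → W (A ++ M ++ B) ≡ initOr L A ++ lastOr L A ∷ M ++ headOr R B ∷ tailW B
  W-split A M B = begin
      L ∷ (A ++ M ++ B) ++ [ R ]
    ≡⟨ cong (L ∷_) (trans (++-assoc A (M ++ B) [ R ]) (cong (A ++_) (++-assoc M B [ R ]))) ⟩
      (L ∷ A) ++ M ++ B ++ [ R ]
    ≡⟨ cong₂ (λ P Q → P ++ M ++ Q) (∷-initOr-lastOr L A) (∷ʳ-headOr B) ⟩
      (initOr L A ++ [ lastOr L A ]) ++ M ++ headOr R B ∷ tailW B
    ≡⟨ ++-assoc (initOr L A) _ _ ⟩
      initOr L A ++ lastOr L A ∷ M ++ headOr R B ∷ tailW B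
    ∎
    where open ≡-Reasoning

  W-segment : ∀ A m₁ K mₖ B →
    W (A ++ (m₁ ∷ K ++ [ mₖ ]) ++ B) ≡ initOr L A ++ lastOr L A ∷ m₁ ∷ K ++ mₖ ∷ headOr R B ∷ tailW B
  W-segment A m₁ K mₖ B =
    trans (W-split A _ B) (cong (λ z → initOr L A ++ lastOr L A ∷ m₁ ∷ z) (++-assoc K [ mₖ ] _))

  W-reversed-segment : ∀ A m₁ K mₖ B →
    W (A ++ reverse (m₁ ∷ K ++ [ mₖ ]) ++ B) ≡ initOr L A ++ lastOr L A ∷ mₖ ∷ reverse K ++ m₁ ∷ headOr R B ∷ tailW B
  W-reversed-segment A m₁ K mₖ B =
    trans (cong (λ M → W (A ++ M ++ B)) (reverse-∷-∷ʳ m₁ K mₖ)) (W-segment A mₖ (reverse K) m₁ B)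

  reverse-samePinnacles : ∀ A m₁ K mₖ B → let M = m₁ ∷ K ++ [ mₖ ] ; x = lastOr L A ; y = headOr R B in
    (∀ {v u} → Edge x mₖ v u ⊎ Edge m₁ y v u → LocalMax (W (A ++ M ++ B)) v → u < v) →
    (∀ {v u} → Edge x m₁ v u ⊎ Edge mₖ y v u → LocalMax (W (A ++ reverse M ++ B)) v → u < v) →
    SamePinnacles (A ++ M ++ B) (A ++ reverse M ++ B)
  reverse-samePinnacles A m₁ K mₖ B new-edges old-edges v =
    mk⇔ (∈-resp-↭ perm) (∈-resp-↭ (↭-sym perm)) ×-⇔
    subst₂ (λ w w′ → LocalMax w v ⇔ LocalMax w′ v) (sym (W-segment A m₁ K mₖ B)) (sym (W-reversed-segment A m₁ K mₖ B))
      (localMax-reverse⇔ (initOr L A) (lastOr L A) m₁ K mₖ (headOr R B) (tailW B)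
        (λ e lm → new-edges e (subst (λ w → LocalMax w v) (sym (W-segment A m₁ K mₖ B)) lm))
        (λ e lm → old-edges e (subst (λ w → LocalMax w v) (sym (W-reversed-segment A m₁ K mₖ B)) lm)))
    where
    perm : A ++ (m₁ ∷ K ++ [ mₖ ]) ++ B ↭ A ++ reverse (m₁ ∷ K ++ [ mₖ ]) ++ B
    perm = zoom A {t = B} (↭-sym (↭-reverse (m₁ ∷ K ++ [ mₖ ])))

  Reversals-↭ : ∀ {π Rs σ} → Reversals π Rs σ → π ↭ σ
  Reversals-↭ done               = ↭-refl
  Reversals-↭ (step A M B _ _ r) = ↭-trans (zoom A (↭-sym (↭-reverse M))) (Reversals-↭ r)

  Reversals-samePinnacles : ∀ {π Rs σ} → Reversals π Rs σ → SamePinnacles π σ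
  Reversals-samePinnacles done                v = ⇔-id _
  Reversals-samePinnacles (step A M B _ pe r) v = Reversals-samePinnacles r v ⇔-∘ pe v

  Reversals-++ : ∀ {π Rs σ Rs′ τ} → Reversals π Rs σ → Reversals σ Rs′ τ → Reversals π (Rs ++ Rs′) τ
  Reversals-++ done                 r′ = r′
  Reversals-++ (step A M B l pe r) r′ = step A M B l pe (Reversals-++ r r′)

  Bounded : List ℕ → Set
  Bounded π = ∀ v → v ∈ π → v < L × v < R

  first-not-pinnacle : ∀ r ρ → r < L → ¬ LocalMax (W (r ∷ ρ)) r
  first-not-pinnacle r ρ r<L lm = <-asym r<L (lm L front˘)

  last-not-pinnacle : ∀ ρ r → r < R → ¬ LocalMax (W (ρ ++ [ r ])) r
  last-not-pinnacle ρ r r<R lm =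
    <-asym r<R (lm R (later (subst (λ w → Adjacent w r R) (sym (++-assoc ρ [ r ] [ R ])) (adjacent-++ʳ ρ front))))

  SuffixPinnacle : List ℕ → ℕ → Set
  SuffixPinnacle E v = v ∈ E × LocalMax (E ++ [ R ]) v

  W-++-∷ : ∀ ρ₀ r e E′ → W ((ρ₀ ++ [ r ]) ++ e ∷ E′) ≡ (L ∷ ρ₀) ++ r ∷ e ∷ E′ ++ [ R ]
  W-++-∷ ρ₀ r e E′ = cong (L ∷_) (trans (++-assoc (ρ₀ ++ [ r ]) (e ∷ E′) [ R ]) (++-assoc ρ₀ [ r ] _))

  junction-adjacent : ∀ ρ₀ r e E′ → Adjacent (W ((ρ₀ ++ [ r ]) ++ e ∷ E′)) e r
  junction-adjacent ρ₀ r e E′ =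
    subst (λ w → Adjacent w e r) (sym (W-++-∷ ρ₀ r e E′)) (adjacent-++ʳ (L ∷ ρ₀) front˘)

  pinnacle-++ : ∀ ρ₀ r e E′ → Bounded (ρ₀ ++ [ r ]) → Bounded (e ∷ E′) → Disjoint (ρ₀ ++ [ r ]) (e ∷ E′) → r < e →
    ∀ v → Pinnacle ((ρ₀ ++ [ r ]) ++ e ∷ E′) v ⇔ (Pinnacle (ρ₀ ++ [ r ]) v ⊎ SuffixPinnacle (e ∷ E′) v)
  pinnacle-++ ρ₀ r e E′ bρ bE dj r<e v = mk⇔ split join
    where
    ρ E : List ℕ
    ρ = ρ₀ ++ [ r ]
    E = e ∷ E′

    cast : ∀ {w w′ : List ℕ} {u u′} → w ≡ w′ → Adjacent w u u′ → Adjacent w′ u u′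
    cast refl a = a

    W-joined : W (ρ ++ E) ≡ (L ∷ ρ₀) ++ r ∷ e ∷ E′ ++ [ R ]
    W-joined = W-++-∷ ρ₀ r e E′

    W-left : W ρ ≡ (L ∷ ρ₀) ++ r ∷ R ∷ []
    W-left = cong (L ∷_) (++-assoc ρ₀ [ r ] [ R ])

    in-left : ∀ {u u′} → Adjacent ((L ∷ ρ₀) ++ [ r ]) u u′ → Adjacent (W (ρ ++ E)) u u′
    in-left a = cast (sym W-joined) (adjacent-∷ʳ-++ (L ∷ ρ₀) _ a)

    in-right : ∀ {u u′} → Adjacent (E ++ [ R ]) u u′ → Adjacent (W (ρ ++ E)) u u′
    in-right a = cast (sym W-joined) (adjacent-++ʳ (L ∷ ρ₀) (later a))

    joined-adjacent : ∀ {u} → Adjacent (W (ρ ++ E)) v u →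
                      Adjacent ((L ∷ ρ₀) ++ [ r ]) v u ⊎ Edge r e v u ⊎ Adjacent (E ++ [ R ]) v u
    joined-adjacent a with adjacent-split (L ∷ ρ₀) r (e ∷ E′ ++ [ R ]) (cast W-joined a)
    ... | inj₁ b = inj₁ b
    ... | inj₂ b with adjacent-∷ b
    ... | inj₁ edge = inj₂ (inj₁ edge)
    ... | inj₂ c    = inj₂ (inj₂ c)

    split : Pinnacle (ρ ++ E) v → Pinnacle ρ v ⊎ SuffixPinnacle E v
    split (i , lm) with ∈-++⁻ ρ i
    ... | inj₂ iE = inj₂ (iE , λ u a → lm u (in-right a))
    ... | inj₁ iρ = inj₁ (iρ , λ u a → smaller u (adjacent-split (L ∷ ρ₀) r (R ∷ []) (cast W-left a)))
      where
      smaller : ∀ u → Adjacent ((L ∷ ρ₀) ++ [ r ]) v u ⊎ Adjacent (r ∷ R ∷ []) v u → u < v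
      smaller u (inj₁ b)         = lm u (in-left b)
      smaller u (inj₂ front)     = ⊥-elim (<-asym r<e (lm e (adjacent-sym (junction-adjacent ρ₀ r e E′))))
      smaller u (inj₂ front˘)    = ⊥-elim (<-irrefl refl (proj₂ (bρ v iρ)))
      smaller u (inj₂ (later (later ())))

    join : Pinnacle ρ v ⊎ SuffixPinnacle E v → Pinnacle (ρ ++ E) v
    join (inj₁ (iρ , lm)) = ∈-++⁺ˡ iρ , λ u a → smaller u (joined-adjacent a)
      where
      smaller : ∀ u → Adjacent ((L ∷ ρ₀) ++ [ r ]) v u ⊎ Edge r e v u ⊎ Adjacent (E ++ [ R ]) v u → u < v
      smaller u (inj₁ b)         = lm u (cast (sym W-left) (adjacent-∷ʳ-++ (L ∷ ρ₀) _ b))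
      smaller u (inj₂ (inj₁ fwd)) =
        ⊥-elim (<-asym (proj₂ (bρ r (∈-++⁺ʳ ρ₀ (here refl)))) (lm R (cast (sym W-left) (adjacent-++ʳ (L ∷ ρ₀) front))))
      smaller u (inj₂ (inj₁ bwd)) = ⊥-elim (dj (iρ , here refl))
      smaller u (inj₂ (inj₂ c)) with ∈-++⁻ E (adjacent-∈ c)
      ... | inj₁ iE        = ⊥-elim (dj (iρ , iE))
      ... | inj₂ (here refl) = ⊥-elim (<-irrefl refl (proj₂ (bρ v iρ)))
    join (inj₂ (iE , lm)) = ∈-++⁺ʳ ρ iE , λ u a → smaller u (joined-adjacent a)
      where
      smaller : ∀ u → Adjacent ((L ∷ ρ₀) ++ [ r ]) v u ⊎ Edge r e v u ⊎ Adjacent (E ++ [ R ]) v u → u < v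
      smaller u (inj₁ b) with adjacent-∈ b
      ... | here refl = ⊥-elim (<-irrefl refl (proj₁ (bE v iE)))
      ... | there iρ  = ⊥-elim (dj (iρ , iE))
      smaller u (inj₂ (inj₁ fwd)) = ⊥-elim (dj (∈-++⁺ʳ ρ₀ (here refl) , iE))
      smaller u (inj₂ (inj₁ bwd)) = r<e
      smaller u (inj₂ (inj₂ c))   = lm u c

  Extendable : ℕ → List ℕ → List ℕ → Set
  Extendable e E′ τ = 1 ≤ length τ × Bounded τ × Disjoint τ (e ∷ E′) × (∀ v → v ∈ τ → ¬ Pinnacle τ v → v < e)

  extendable-pinnacle-++ : ∀ {e E′ τ} → Bounded (e ∷ E′) → Extendable e E′ τ →
    ∀ v → Pinnacle (τ ++ e ∷ E′) v ⇔ (Pinnacle τ v ⊎ SuffixPinnacle (e ∷ E′) v)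
  extendable-pinnacle-++ {e} {E′} {τ} bE (l , bτ , dj , small) with ∷ʳ-view τ l
  ... | ρ₀ , r , refl = pinnacle-++ ρ₀ r e E′ bτ bE dj (small r r∈τ (λ p → last-not-pinnacle ρ₀ r (proj₂ (bτ r r∈τ)) (proj₂ p)))
    where
    r∈τ : r ∈ ρ₀ ++ [ r ]
    r∈τ = ∈-++⁺ʳ ρ₀ (here refl)

  extendable-resp : ∀ {e E′ τ τ′} → τ ↭ τ′ → SamePinnacles τ τ′ → Extendable e E′ τ → Extendable e E′ τ′
  extendable-resp p pe (l , bτ , dj , small) =
    subst (1 ≤_) (↭-length p) l ,
    (λ v i → bτ v (∈-resp-↭ (↭-sym p) i)) ,
    (λ (i , j) → dj (∈-resp-↭ (↭-sym p) i , j)) ,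
    (λ v i np → small v (∈-resp-↭ (↭-sym p) i) (λ q → np (Equivalence.to (pe v) q)))

  Reversals-++ʳ : ∀ {e E′ τ Rs σ} → Bounded (e ∷ E′) → Extendable e E′ τ →
    Reversals τ Rs σ → Reversals (τ ++ e ∷ E′) Rs (σ ++ e ∷ E′)
  Reversals-++ʳ bE ext done = done
  Reversals-++ʳ {e} {E′} bE ext (step A M B l pe r) =
    subst (λ π → Reversals π _ _) (sym (assoc M))
      (step A M (B ++ E) l (subst₂ SamePinnacles (assoc M) (assoc (reverse M)) pe-E)
        (subst (λ π → Reversals π _ _) (assoc (reverse M)) (Reversals-++ʳ bE ext′ r)))
    where
    E : List ℕ
    E = e ∷ E′
    assoc : ∀ N → (A ++ N ++ B) ++ E ≡ A ++ N ++ B ++ E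
    assoc N = trans (++-assoc A (N ++ B) E) (cong (A ++_) (++-assoc N B E))
    ext′ : Extendable e E′ (A ++ reverse M ++ B)
    ext′ = extendable-resp (zoom A (↭-sym (↭-reverse M))) pe ext
    pe-E : SamePinnacles ((A ++ M ++ B) ++ E) ((A ++ reverse M ++ B) ++ E)
    pe-E v = ⇔-sym (extendable-pinnacle-++ bE ext′ v) ⇔-∘ ((pe v ⊎-⇔ ⇔-id _) ⇔-∘ extendable-pinnacle-++ bE ext v)

  last-not-pinnacle-++ : ∀ A M b → b < R → ¬ LocalMax (W (A ++ M ++ [ b ])) b
  last-not-pinnacle-++ A M b b<R lm =
    last-not-pinnacle (A ++ M) b b<R (subst (λ π → LocalMax (W π) b) (sym (++-assoc A M [ b ])) lm)

  OneReversal : List ℕ → List ℕ → Set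
  OneReversal π σ = ∃ λ ab → Reversals π [ ab ] σ

  module Segment (A : List ℕ) (m₁ : ℕ) (K : List ℕ) (mₖ : ℕ) (B : List ℕ) where
    M before after : List ℕ
    M      = m₁ ∷ K ++ [ mₖ ]
    before = A ++ M ++ B
    after  = A ++ reverse M ++ B

    x y : ℕ
    x = lastOr L A
    y = headOr R B

    private
      cast : ∀ {w w′ : List ℕ} {u u′} → w ≡ w′ → Adjacent w′ u u′ → Adjacent w u u′
      cast refl a = a

    x-m₁ : Adjacent (W before) x m₁
    x-m₁ = cast (W-segment A m₁ K mₖ B) (adjacent-++ʳ (initOr L A) front)

    mₖ-y : Adjacent (W before) mₖ y
    mₖ-y = cast (W-segment A m₁ K mₖ B) (adjacent-++ʳ (initOr L A) (later (later (adjacent-++ʳ K front))))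

    x-mₖ : Adjacent (W after) x mₖ
    x-mₖ = cast (W-reversed-segment A m₁ K mₖ B) (adjacent-++ʳ (initOr L A) front)

    m₁-y : Adjacent (W after) m₁ y
    m₁-y = cast (W-reversed-segment A m₁ K mₖ B) (adjacent-++ʳ (initOr L A) (later (later (adjacent-++ʳ (reverse K) front))))

    m₁∈ : m₁ ∈ before
    m₁∈ = ∈-++⁺ʳ A (here refl)

    mₖ∈ : mₖ ∈ before
    mₖ∈ = ∈-++⁺ʳ A (∈-++⁺ˡ (there (∈-++⁺ʳ K (here refl))))

    reversal : (∀ {v v′} → Edge x mₖ v v′ ⊎ Edge m₁ y v v′ → LocalMax (W before) v → v′ < v) →
               (∀ {v v′} → Edge x m₁ v v′ ⊎ Edge mₖ y v v′ → LocalMax (W after) v → v′ < v) →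
               OneReversal before after
    reversal new-edges old-edges = _ , step A M B (s≤s z≤n) (reverse-samePinnacles A m₁ K mₖ B new-edges old-edges) done

  reverse-all : ∀ π → 2 ≤ length π → Bounded π → OneReversal π (reverse π)
  reverse-all (a ∷ [])     (s≤s ()) _
  reverse-all (a ∷ b ∷ π′) _ bd with ∷ʳ-view (b ∷ π′) (s≤s z≤n)
  ... | K , mₖ , eq = subst₂ OneReversal e₁ e₂ (reversal new-edges old-edges)
    where
    open Segment [] a K mₖ []
    e₁ : before ≡ a ∷ b ∷ π′
    e₁ = trans (++-identityʳ _) (cong (a ∷_) (sym eq))
    e₂ : after ≡ reverse (a ∷ b ∷ π′)
    e₂ = trans (++-identityʳ _) (cong (λ z → reverse (a ∷ z)) (sym eq))
    bₐ : a < L × a < R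
    bₐ = bd a (here refl)
    bₖ : mₖ < L × mₖ < R
    bₖ = bd mₖ (subst (mₖ ∈_) e₁ mₖ∈)
    new-edges : ∀ {v v′} → Edge L mₖ v v′ ⊎ Edge a R v v′ → LocalMax (W before) v → v′ < v
    new-edges (inj₁ fwd) _  = proj₁ bₖ
    new-edges (inj₁ bwd) lm = ⊥-elim (<-asym (proj₂ bₖ) (lm R mₖ-y))
    new-edges (inj₂ fwd) lm = ⊥-elim (<-asym (proj₁ bₐ) (lm L (adjacent-sym x-m₁)))
    new-edges (inj₂ bwd) _  = proj₂ bₐ
    old-edges : ∀ {v v′} → Edge L a v v′ ⊎ Edge mₖ R v v′ → LocalMax (W after) v → v′ < v
    old-edges (inj₁ fwd) _  = proj₁ bₐ
    old-edges (inj₁ bwd) lm = ⊥-elim (<-asym (proj₂ bₐ) (lm R m₁-y))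
    old-edges (inj₂ fwd) lm = ⊥-elim (<-asym (proj₁ bₖ) (lm L (adjacent-sym x-mₖ)))
    old-edges (inj₂ bwd) _  = proj₂ bₖ

  move-to-end : ∀ A₀ w m N → 1 ≤ length N → let π = (A₀ ++ [ w ]) ++ m ∷ N in
    Bounded π → ¬ Pinnacle π m → (∀ v → v ∈ π → ¬ Pinnacle π v → v ≤ m) → m < w →
    OneReversal π (((A₀ ++ [ w ]) ++ reverse N) ++ [ m ])
  move-to-end A₀ w m N ne bd npm le m<w with ∷ʳ-view N ne
  ... | K , mₖ , refl = subst₂ OneReversal e₁ e₂ (reversal new-edges old-edges)
    where
    open Segment (A₀ ++ [ w ]) m K mₖ []
    e₁ : before ≡ (A₀ ++ [ w ]) ++ m ∷ K ++ [ mₖ ]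
    e₁ = cong ((A₀ ++ [ w ]) ++_) (++-identityʳ _)
    e₂ : after ≡ ((A₀ ++ [ w ]) ++ reverse (K ++ [ mₖ ])) ++ [ m ]
    e₂ = trans (cong ((A₀ ++ [ w ]) ++_) (trans (++-identityʳ _) (unfold-reverse m (K ++ [ mₖ ]))))
               (sym (++-assoc (A₀ ++ [ w ]) _ [ m ]))
    x≡w : x ≡ w
    x≡w = lastOr-∷ʳ L A₀ w
    bₘ : m < L × m < R
    bₘ = bd m (subst (m ∈_) e₁ m₁∈)
    bₖ : mₖ < L × mₖ < R
    bₖ = bd mₖ (subst (mₖ ∈_) e₁ mₖ∈)
    mₖ≤m : mₖ ≤ m
    mₖ≤m = le mₖ (subst (mₖ ∈_) e₁ mₖ∈)
             (λ p → <-asym (proj₂ bₖ) (proj₂ p R (subst (λ π → Adjacent (W π) mₖ R) e₁ mₖ-y)))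
    mₖ<x : mₖ < x
    mₖ<x = subst (mₖ <_) (sym x≡w) (≤-<-trans mₖ≤m m<w)
    new-edges : ∀ {v v′} → Edge x mₖ v v′ ⊎ Edge m R v v′ → LocalMax (W before) v → v′ < v
    new-edges (inj₁ fwd) _  = mₖ<x
    new-edges (inj₁ bwd) lm = ⊥-elim (<-asym (proj₂ bₖ) (lm R mₖ-y))
    new-edges (inj₂ fwd) lm = ⊥-elim (npm (subst (m ∈_) e₁ m₁∈ , subst (λ π → LocalMax (W π) m) e₁ lm))
    new-edges (inj₂ bwd) _  = proj₂ bₘ
    old-edges : ∀ {v v′} → Edge x m v v′ ⊎ Edge mₖ R v v′ → LocalMax (W after) v → v′ < v
    old-edges (inj₁ fwd) _  = subst (m <_) (sym x≡w) m<w
    old-edges (inj₁ bwd) lm = ⊥-elim (<-asym (proj₂ bₘ) (lm R m₁-y))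
    old-edges (inj₂ fwd) lm = ⊥-elim (<-asym mₖ<x (lm x (adjacent-sym x-mₖ)))
    old-edges (inj₂ bwd) _  = proj₂ bₖ

  reverse-after-non-pinnacle : ∀ X u w Y z m → let π = (X ++ [ u ]) ++ (w ∷ Y ++ [ z ]) ++ [ m ] in
    Bounded π → ¬ Pinnacle π u → ¬ Pinnacle π w → u ≤ m → w ≤ m → m < z →
    OneReversal π ((X ++ [ u ]) ++ reverse (w ∷ Y ++ [ z ]) ++ [ m ])
  reverse-after-non-pinnacle X u w Y z m bd npu npw u≤m w≤m m<z = reversal new-edges old-edges
    where
    open Segment (X ++ [ u ]) w Y z [ m ]
    x≡u : x ≡ u
    x≡u = lastOr-∷ʳ L X u
    x<z : x < z
    x<z = subst (_< z) (sym x≡u) (≤-<-trans u≤m m<z)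
    m<R : m < R
    m<R = proj₂ (bd m (∈-++⁺ʳ (X ++ [ u ]) (∈-++⁺ʳ (w ∷ Y ++ [ z ]) (here refl))))
    new-edges : ∀ {v v′} → Edge x z v v′ ⊎ Edge w m v v′ → LocalMax (W before) v → v′ < v
    new-edges (inj₁ fwd) lm = ⊥-elim (npu (∈-++⁺ˡ (∈-++⁺ʳ X (here refl)) , subst (LocalMax (W before)) x≡u lm))
    new-edges (inj₁ bwd) _  = x<z
    new-edges (inj₂ fwd) lm = ⊥-elim (npw (m₁∈ , lm))
    new-edges (inj₂ bwd) lm = ⊥-elim (last-not-pinnacle-++ (X ++ [ u ]) M m m<R lm)
    old-edges : ∀ {v v′} → Edge x w v v′ ⊎ Edge z m v v′ → LocalMax (W after) v → v′ < v
    old-edges (inj₁ fwd) lm = ⊥-elim (<-asym x<z (lm z x-mₖ))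
    old-edges (inj₁ bwd) lm = ⊥-elim (<⇒≱ (lm m m₁-y) w≤m)
    old-edges (inj₂ fwd) _  = m<z
    old-edges (inj₂ bwd) lm = ⊥-elim (last-not-pinnacle-++ (X ++ [ u ]) (reverse M) m m<R lm)

  reverse-from-max-pinnacle : ∀ X p Z z m → let π = X ++ (p ∷ Z ++ [ z ]) ++ [ m ] in
    Bounded π → Pinnacle π p → (∀ v → v ∈ π → ¬ Pinnacle π v → v ≤ m) → m < z → z ≤ p →
    OneReversal π (X ++ reverse (p ∷ Z ++ [ z ]) ++ [ m ])
  reverse-from-max-pinnacle X p Z z m bd pin-p le m<z z≤p = reversal new-edges old-edges
    where
    open Segment X p Z z [ m ]
    m<R : m < R
    m<R = proj₂ (bd m (∈-++⁺ʳ X (∈-++⁺ʳ (p ∷ Z ++ [ z ]) (here refl))))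
    x<p : x < p
    x<p = proj₂ pin-p x (adjacent-sym x-m₁)
    x≤m : x ≤ m
    x≤m = left-neighbour X refl
      where
      left-neighbour : ∀ X′ → X′ ≡ X → x ≤ m
      left-neighbour []       refl = ⊥-elim (<-asym x<p (proj₁ (bd p m₁∈)))
      left-neighbour (a ∷ as) refl = le x (∈-++⁺ˡ (lastOr-∈ a as)) (λ q → <-asym x<p (proj₂ q p x-m₁))
    new-edges : ∀ {v v′} → Edge x z v v′ ⊎ Edge p m v v′ → LocalMax (W before) v → v′ < v
    new-edges (inj₁ fwd) lm = ⊥-elim (<-asym x<p (lm p x-m₁))
    new-edges (inj₁ bwd) _  = ≤-<-trans x≤m m<z
    new-edges (inj₂ fwd) _  = <-≤-trans m<z z≤p
    new-edges (inj₂ bwd) lm = ⊥-elim (last-not-pinnacle-++ X M m m<R lm)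
    old-edges : ∀ {v v′} → Edge x p v v′ ⊎ Edge z m v v′ → LocalMax (W after) v → v′ < v
    old-edges (inj₁ fwd) lm = ⊥-elim (<-asym (≤-<-trans x≤m m<z) (lm z x-mₖ))
    old-edges (inj₁ bwd) _  = x<p
    old-edges (inj₂ fwd) _  = m<z
    old-edges (inj₂ bwd) lm = ⊥-elim (last-not-pinnacle-++ X (reverse M) m m<R lm)

module Sorting (L R : ℕ) (L≢R : L ≢ R) where
  open Sentinels L R

  record PinnacleSplit (π C S : List ℕ) : Set where
    field
      S⊆pinnacles    : ∀ {v} → v ∈ S → Pinnacle π v
      pinnacles⊆S    : ∀ {v} → Pinnacle π v → v ∈ S
      C⊆nonPinnacles : ∀ {v} → v ∈ C → v ∈ π × ¬ Pinnacle π v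
      nonPinnacles⊆C : ∀ {v} → v ∈ π → ¬ Pinnacle π v → v ∈ C
  open PinnacleSplit public

  WellFormed : List ℕ → Set
  WellFormed π = Unique π × Bounded π

  record SortingWithin (b : ℕ) (π C S : List ℕ) : Set where
    constructor sorting
    field
      moves   : List (ℕ × ℕ)
      reaches : Reversals π moves (interleave C S)
      budget  : length moves + length S + 2 ≤ b

  Sortable : List ℕ → Set
  Sortable τ = ∀ C S → WellFormed τ → 1 ≤ length τ → AllPairs _<_ C → AllPairs _<_ S →
               PinnacleSplit τ C S → SortingWithin (2 * length τ) τ C S

  Unique-W : ∀ {π} → WellFormed π → Unique (W π)
  Unique-W {π} (u , bd) = tabulate L∉ ∷ Unique.++⁺ u ([] ∷ []) R∉
    where
    L∉ : ∀ {v} → v ∈ π ++ [ R ] → L ≢ v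
    L∉ i with ∈-++⁻ π i
    ... | inj₁ j         = λ L≡v → <-irrefl (sym L≡v) (proj₁ (bd _ j))
    ... | inj₂ (here refl) = L≢R
    R∉ : Disjoint π [ R ]
    R∉ (j , here refl) = <-irrefl refl (proj₂ (bd _ j))

  WellFormed-Reversals : ∀ {π Rs σ} → Reversals π Rs σ → WellFormed π → WellFormed σ
  WellFormed-Reversals {π} {σ = σ} r (u , bd) = Unique-resp-↭ p u , λ v i → bd v (∈-resp-↭ (↭-sym p) i)
    where
    p : π ↭ σ
    p = Reversals-↭ r

  PinnacleSplit-Reversals : ∀ {π Rs σ C S} → Reversals π Rs σ → PinnacleSplit π C S → PinnacleSplit σ C S
  PinnacleSplit-Reversals {π} {σ = σ} r sp = record
    { S⊆pinnacles    = λ i → to (S⊆pinnacles sp i)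
    ; pinnacles⊆S    = λ q → pinnacles⊆S sp (from q)
    ; C⊆nonPinnacles = λ i → let (j , np) = C⊆nonPinnacles sp i in ∈-resp-↭ p j , λ q → np (from q)
    ; nonPinnacles⊆C = λ i np → nonPinnacles⊆C sp (∈-resp-↭ (↭-sym p) i) (λ q → np (to q))
    }
    where
    p : π ↭ σ
    p = Reversals-↭ r
    to : ∀ {v} → Pinnacle π v → Pinnacle σ v
    to {v} = Equivalence.to (Reversals-samePinnacles r v)
    from : ∀ {v} → Pinnacle σ v → Pinnacle π v
    from {v} = Equivalence.from (Reversals-samePinnacles r v)

  left-neighbour-larger : ∀ A₀ w m c B → let π = (A₀ ++ [ w ]) ++ m ∷ c ∷ B in
    WellFormed π → ¬ Pinnacle π m → c < m → m < w
  left-neighbour-larger A₀ w m c B wf np c<m with <-cmp m w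
  ... | tri< m<w _ _ = m<w
  ... | tri≈ _ refl _ = ⊥-elim (proj₂ (proj₂ (Unique-++⁻ (A₀ ++ [ w ]) (m ∷ c ∷ B) (proj₁ wf))) (∈-++⁺ʳ A₀ (here refl) , here refl))
  ... | tri> _ _ w<m = ⊥-elim (np (∈-++⁺ʳ (A₀ ++ [ w ]) (here refl) , localMax))
    where
    W≡ : W ((A₀ ++ [ w ]) ++ m ∷ c ∷ B) ≡ (L ∷ A₀) ++ w ∷ m ∷ c ∷ B ++ [ R ]
    W≡ = cong (L ∷_) (trans (++-assoc (A₀ ++ [ w ]) (m ∷ c ∷ B) [ R ]) (++-assoc A₀ [ w ] _))
    localMax : LocalMax (W ((A₀ ++ [ w ]) ++ m ∷ c ∷ B)) m
    localMax u a with neighbours-unique (L ∷ A₀) w m c (B ++ [ R ]) (subst Unique W≡ (Unique-W wf))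
                        (subst (λ z → Adjacent z m u) W≡ a)
    ... | inj₁ refl = w<m
    ... | inj₂ refl = c<m

  -- If |C| ≤ |S| then interleave C S ends with a letter of S, and a last letter is never a pinnacle.
  interleave-reachable⇒C≰S : ∀ {τ Rs} C S → 1 ≤ length τ → Bounded τ → PinnacleSplit τ C S →
                             Reversals τ Rs (interleave C S) → ¬ length C ≤ length S
  interleave-reachable⇒C≰S []      []      ne bd sp r _   = <-irrefl (sym (↭-length (Reversals-↭ r))) ne
  interleave-reachable⇒C≰S (_ ∷ _) []      ne bd sp r ()
  interleave-reachable⇒C≰S {τ} C   (s ∷ S) ne bd sp r C≤S with interleave-ends-in-S C (s ∷ S) C≤S (s≤s z≤n)
  ... | σ , t , eq , t∈S = last-not-pinnacle σ t (proj₂ (bd t (proj₁ pin-t)))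
                             (proj₂ (subst (λ π → Pinnacle π t) eq (Equivalence.to (Reversals-samePinnacles r t) pin-t)))
    where
    pin-t : Pinnacle τ t
    pin-t = S⊆pinnacles sp t∈S

  PinnacleSplit-++⁻ : ∀ {ρ E C′ CE S′ SE} → Disjoint ρ E → (∀ {v} → v ∈ E ⇔ (v ∈ CE ⊎ v ∈ SE)) →
    (∀ {v} → Pinnacle (ρ ++ E) v → Pinnacle ρ v ⊎ v ∈ SE) → (∀ {v} → Pinnacle ρ v → Pinnacle (ρ ++ E) v) →
    Disjoint C′ CE → Disjoint S′ SE → PinnacleSplit (ρ ++ E) (C′ ++ CE) (S′ ++ SE) → PinnacleSplit ρ C′ S′
  PinnacleSplit-++⁻ {ρ} {E} {C′} {CE} {S′} {SE} ρ∩E E-split restrict extend C′∩CE S′∩SE sp = record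
    { S⊆pinnacles    = S⊆
    ; pinnacles⊆S    = ⊆S
    ; C⊆nonPinnacles = C⊆
    ; nonPinnacles⊆C = ⊆C
    }
    where
    open Equivalence using (to; from)
    S⊆ : ∀ {v} → v ∈ S′ → Pinnacle ρ v
    S⊆ i with restrict (S⊆pinnacles sp (∈-++⁺ˡ i))
    ... | inj₁ p = p
    ... | inj₂ j = ⊥-elim (S′∩SE (i , j))
    ⊆S : ∀ {v} → Pinnacle ρ v → v ∈ S′
    ⊆S p with ∈-++⁻ S′ (pinnacles⊆S sp (extend p))
    ... | inj₁ i = i
    ... | inj₂ j = ⊥-elim (ρ∩E (proj₁ p , from E-split (inj₂ j)))
    C⊆ : ∀ {v} → v ∈ C′ → v ∈ ρ × ¬ Pinnacle ρ v
    C⊆ i with C⊆nonPinnacles sp (∈-++⁺ˡ i)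
    ... | j , np with ∈-++⁻ ρ j
    ...   | inj₁ k = k , λ p → np (extend p)
    ...   | inj₂ e with to E-split e
    ...     | inj₁ c = ⊥-elim (C′∩CE (i , c))
    ...     | inj₂ s = ⊥-elim (np (S⊆pinnacles sp (∈-++⁺ʳ S′ s)))
    ⊆C : ∀ {v} → v ∈ ρ → ¬ Pinnacle ρ v → v ∈ C′
    ⊆C j np with ∈-++⁻ C′ (nonPinnacles⊆C sp (∈-++⁺ˡ j) np′)
      where
      np′ : ¬ Pinnacle (ρ ++ E) _
      np′ q with restrict q
      ... | inj₁ p = np p
      ... | inj₂ s = ρ∩E (j , from E-split (inj₂ s))
    ... | inj₁ i = i
    ... | inj₂ c = ⊥-elim (ρ∩E (j , from E-split (inj₁ c)))

  sort-∷ʳ-max : ∀ τ₀ y m C′ S → let τ = τ₀ ++ [ y ] in Sortable τ →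
    WellFormed (τ ++ [ m ]) → PinnacleSplit (τ ++ [ m ]) (C′ ++ [ m ]) S →
    AllPairs _<_ (C′ ++ [ m ]) → AllPairs _<_ S → y < m → SortingWithin (2 * length τ) (τ ++ [ m ]) (C′ ++ [ m ]) S
  sort-∷ʳ-max τ₀ y m C′ S sortable (u , bd) sp <C <S y<m =
    sorting Rs (subst (Reversals _ Rs) (sym (interleave-∷ʳ C′ S m S≤C′)) (Reversals-++ʳ b[m] extendable r)) budget
    where
    τ : List ℕ
    τ = τ₀ ++ [ y ]
    ne : 1 ≤ length τ
    ne = 1≤length-∷ʳ τ₀ y
    uτ : Unique τ
    uτ = proj₁ (Unique-++⁻ τ [ m ] u)
    τ∩m : Disjoint τ [ m ]
    τ∩m = proj₂ (proj₂ (Unique-++⁻ τ [ m ] u))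
    bτ : Bounded τ
    bτ v i = bd v (∈-++⁺ˡ i)
    b[m] : Bounded [ m ]
    b[m] v i = bd v (∈-++⁺ʳ τ i)
    <C′ : AllPairs _<_ C′
    <C′ = proj₁ (AllPairs-++⁻ C′ [ m ] <C)
    C′<m : ∀ {c} → c ∈ C′ → c < m
    C′<m i = proj₂ (proj₂ (AllPairs-++⁻ C′ [ m ] <C)) i (here refl)
    pin⇔ : ∀ v → Pinnacle (τ ++ [ m ]) v ⇔ (Pinnacle τ v ⊎ SuffixPinnacle [ m ] v)
    pin⇔ = pinnacle-++ τ₀ y m [] bτ b[m] τ∩m y<m
    restrict : ∀ {v} → Pinnacle (τ ++ [ m ]) v → Pinnacle τ v ⊎ v ∈ []
    restrict q with Equivalence.to (pin⇔ _) q
    ... | inj₁ p = inj₁ p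
    ... | inj₂ (here refl , lm) = ⊥-elim (<-asym (proj₂ (b[m] m (here refl))) (lm R front))
    sp′ : PinnacleSplit τ C′ S
    sp′ = PinnacleSplit-++⁻ {SE = []} τ∩m (mk⇔ inj₁ λ { (inj₁ i) → i ; (inj₂ ()) }) restrict (λ p → Equivalence.from (pin⇔ _) (inj₁ p))
            (λ { (i , here refl) → <-irrefl refl (C′<m i) }) (λ ()) (subst (PinnacleSplit _ _) (sym (++-identityʳ S)) sp)
    recursive : SortingWithin (2 * length τ) τ C′ S
    recursive = sortable C′ S (uτ , bτ) ne <C′ <S sp′
    open SortingWithin recursive renaming (moves to Rs; reaches to r)
    S≤C′ : length S ≤ length C′
    S≤C′ = <⇒≤ (≰⇒> (interleave-reachable⇒C≰S C′ S ne bτ sp′ r))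
    extendable : Extendable m [] τ
    extendable = ne , bτ , τ∩m , λ v i np → C′<m (nonPinnacles⊆C sp′ i np)

  sort-++-pinnacle-max : ∀ τ p m C′ S′ → Sortable τ → 1 ≤ length τ →
    WellFormed (τ ++ p ∷ m ∷ []) → PinnacleSplit (τ ++ p ∷ m ∷ []) (C′ ++ [ m ]) (S′ ++ [ p ]) →
    AllPairs _<_ (C′ ++ [ m ]) → AllPairs _<_ (S′ ++ [ p ]) → m < p → length C′ ≤ suc (length S′) →
    SortingWithin (suc (2 * length τ)) (τ ++ p ∷ m ∷ []) (C′ ++ [ m ]) (S′ ++ [ p ])
  sort-++-pinnacle-max τ p m C′ S′ sortable ne (u , bd) sp <C <S m<p C′≤S′+1 with ∷ʳ-view τ ne
  ... | ρ₀ , r , refl =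
    sorting Rs (subst (Reversals _ Rs) (sym (interleave-∷ʳ-∷ʳ C′ S′ p m C′≡S′+1)) (Reversals-++ʳ bE extendable rs)) budget′
    where
    ρ E : List ℕ
    ρ = ρ₀ ++ [ r ]
    E = p ∷ m ∷ []
    uρ : Unique ρ
    uρ = proj₁ (Unique-++⁻ ρ E u)
    ρ∩E : Disjoint ρ E
    ρ∩E = proj₂ (proj₂ (Unique-++⁻ ρ E u))
    bρ : Bounded ρ
    bρ v i = bd v (∈-++⁺ˡ i)
    bE : Bounded E
    bE v i = bd v (∈-++⁺ʳ ρ i)
    <C′ : AllPairs _<_ C′
    <C′ = proj₁ (AllPairs-++⁻ C′ [ m ] <C)
    C′<m : ∀ {c} → c ∈ C′ → c < m
    C′<m i = proj₂ (proj₂ (AllPairs-++⁻ C′ [ m ] <C)) i (here refl)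
    <S′ : AllPairs _<_ S′
    <S′ = proj₁ (AllPairs-++⁻ S′ [ p ] <S)
    S′<p : ∀ {s} → s ∈ S′ → s < p
    S′<p i = proj₂ (proj₂ (AllPairs-++⁻ S′ [ p ] <S)) i (here refl)
    r<p : r < p
    r<p = proj₂ (S⊆pinnacles sp (∈-++⁺ʳ S′ (here refl))) r (junction-adjacent ρ₀ r p (m ∷ []))
    pin⇔ : ∀ v → Pinnacle (ρ ++ E) v ⇔ (Pinnacle ρ v ⊎ SuffixPinnacle E v)
    pin⇔ = pinnacle-++ ρ₀ r p (m ∷ []) bρ bE ρ∩E r<p
    restrict : ∀ {v} → Pinnacle (ρ ++ E) v → Pinnacle ρ v ⊎ v ∈ [ p ]
    restrict q with Equivalence.to (pin⇔ _) q
    ... | inj₁ pin                   = inj₁ pin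
    ... | inj₂ (here refl , _)        = inj₂ (here refl)
    ... | inj₂ (there (here refl) , lm) = ⊥-elim (<-asym (proj₂ (bE m (there (here refl)))) (lm R (later front)))
    E-split : ∀ {v} → v ∈ E ⇔ (v ∈ [ m ] ⊎ v ∈ [ p ])
    E-split = mk⇔ (λ { (here refl) → inj₂ (here refl) ; (there (here refl)) → inj₁ (here refl) })
                  (λ { (inj₁ (here refl)) → there (here refl) ; (inj₂ (here refl)) → here refl })
    sp′ : PinnacleSplit ρ C′ S′
    sp′ = PinnacleSplit-++⁻ ρ∩E E-split restrict (λ pin → Equivalence.from (pin⇔ _) (inj₁ pin))
            (λ { (i , here refl) → <-irrefl refl (C′<m i) }) (λ { (i , here refl) → <-irrefl refl (S′<p i) }) sp
    recursive : SortingWithin (2 * length ρ) ρ C′ S′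
    recursive = sortable C′ S′ (uρ , bρ) ne <C′ <S′ sp′
    open SortingWithin recursive renaming (moves to Rs; reaches to rs)
    C′≡S′+1 : length C′ ≡ suc (length S′)
    C′≡S′+1 = ≤-antisym C′≤S′+1 (≰⇒> (interleave-reachable⇒C≰S C′ S′ ne bρ sp′ rs))
    extendable : Extendable p (m ∷ []) ρ
    extendable = ne , bρ , ρ∩E , λ v i np → <-trans (C′<m (nonPinnacles⊆C sp′ i np)) m<p
    budget′ : length Rs + length (S′ ++ [ p ]) + 2 ≤ suc (2 * length ρ)
    budget′ rewrite length-∷ʳ S′ p | +-suc (length Rs) (length S′) = s≤s budget

  Reversals-then-sorting : ∀ {π Rs σ b C S} → Reversals π Rs σ → SortingWithin b σ C S → SortingWithin (length Rs + b) π C S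
  Reversals-then-sorting {Rs = Rs₁} {S = S} r₁ (sorting Rs r budget) = sorting (Rs₁ ++ Rs) (Reversals-++ r₁ r) budget′
    where
    budget′ : length (Rs₁ ++ Rs) + length S + 2 ≤ length Rs₁ + _
    budget′ rewrite length-++ Rs₁ {Rs} | +-assoc (length Rs₁) (length Rs) (length S)
                  | +-assoc (length Rs₁) (length Rs + length S) 2 = +-monoʳ-≤ (length Rs₁) budget

  SortingWithin-mono : ∀ {b b′ π C S} → b ≤ b′ → SortingWithin b π C S → SortingWithin b′ π C S
  SortingWithin-mono b≤b′ (sorting Rs r budget) = sorting Rs r (≤-trans budget b≤b′)

  Below : ℕ → Set
  Below n = ∀ τ → length τ < n → Sortable τ

  module MaximalNonPinnacle (C′ : List ℕ) (m : ℕ) (S : List ℕ) (<C : AllPairs _<_ (C′ ++ [ m ])) (<S : AllPairs _<_ S) where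

    Valid : List ℕ → Set
    Valid π = WellFormed π × PinnacleSplit π (C′ ++ [ m ]) S

    ≤m : ∀ {c} → c ∈ C′ ++ [ m ] → c ≤ m
    ≤m i with ∈-++⁻ C′ i
    ... | inj₁ j         = <⇒≤ (proj₂ (proj₂ (AllPairs-++⁻ C′ [ m ] <C)) j (here refl))
    ... | inj₂ (here refl) = ≤-refl

    m∈ : ∀ {π} → Valid π → m ∈ π
    m∈ (_ , sp) = proj₁ (C⊆nonPinnacles sp (∈-++⁺ʳ C′ (here refl)))

    m-not-pinnacle : ∀ {π} → Valid π → ¬ Pinnacle π m
    m-not-pinnacle (_ , sp) = proj₂ (C⊆nonPinnacles sp (∈-++⁺ʳ C′ (here refl)))

    non-pinnacle≤m : ∀ {π} → Valid π → ∀ v → v ∈ π → ¬ Pinnacle π v → v ≤ m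
    non-pinnacle≤m (_ , sp) v i np = ≤m (nonPinnacles⊆C sp i np)

    bounded : ∀ {π} → Valid π → Bounded π
    bounded ((_ , bd) , _) = bd

    Valid-Reversals : ∀ {π Rs σ} → Reversals π Rs σ → Valid π → Valid σ
    Valid-Reversals r (wf , sp) = WellFormed-Reversals r wf , PinnacleSplit-Reversals r sp

    record MovedToEnd (π : List ℕ) : Set where
      constructor moved
      field
        prefix  : List ℕ
        last    : ℕ
        moves   : List (ℕ × ℕ)
        reaches : Reversals π moves ((prefix ++ [ last ]) ++ [ m ])
        cost    : length moves ≤ 1 ⊎ (length moves ≤ 2 × last < m)

    moved-∷ʳ : ∀ {π} τ Rs → 1 ≤ length τ → Reversals π Rs (τ ++ [ m ]) → length Rs ≤ 1 → MovedToEnd π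
    moved-∷ʳ τ Rs ne r cost with ∷ʳ-view τ ne
    ... | τ₀ , y , refl = moved τ₀ y Rs r (inj₁ cost)

    reverse-then-move : ∀ A₀ w N → 1 ≤ length N → w < m → Valid ((A₀ ++ [ w ]) ++ m ∷ N) →
                        MovedToEnd ((A₀ ++ [ w ]) ++ m ∷ N)
    reverse-then-move A₀ w N ne w<m v with ∷ʳ-view (reverse N) (subst (1 ≤_) (sym (length-reverse N)) ne)
    ... | A₀′ , w′ , eq = moved ((A₀′ ++ [ w′ ]) ++ A₀) w _ (Reversals-++ r₁ r₂) (inj₂ (≤-refl , w<m))
      where
      π π′ : List ℕ
      π  = (A₀ ++ [ w ]) ++ m ∷ N
      π′ = (A₀′ ++ [ w′ ]) ++ m ∷ w ∷ reverse A₀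
      reverse-π : reverse π ≡ π′
      reverse-π = begin
          reverse ((A₀ ++ [ w ]) ++ m ∷ N)
        ≡⟨ reverse-++ (A₀ ++ [ w ]) (m ∷ N) ⟩
          reverse (m ∷ N) ++ reverse (A₀ ++ [ w ])
        ≡⟨ cong₂ _++_ (unfold-reverse m N) (reverse-++ A₀ [ w ]) ⟩
          (reverse N ++ [ m ]) ++ w ∷ reverse A₀
        ≡⟨ ++-assoc (reverse N) [ m ] _ ⟩
          reverse N ++ m ∷ w ∷ reverse A₀
        ≡⟨ cong (_++ m ∷ w ∷ reverse A₀) eq ⟩
          π′
        ∎
        where open ≡-Reasoning
      2≤π : 2 ≤ length π
      2≤π = subst (2 ≤_) (sym (length-++ (A₀ ++ [ w ]))) (+-mono-≤ (1≤length-∷ʳ A₀ w) (s≤s z≤n))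
      r₁ : Reversals π _ π′
      r₁ = subst (Reversals π _) reverse-π (proj₂ (reverse-all π 2≤π (bounded v)))
      v′ : Valid π′
      v′ = Valid-Reversals r₁ v
      m<w′ : m < w′
      m<w′ = left-neighbour-larger A₀′ w′ m w (reverse A₀) (proj₁ v′) (m-not-pinnacle v′) w<m
      target : ((A₀′ ++ [ w′ ]) ++ reverse (w ∷ reverse A₀)) ++ [ m ] ≡ (((A₀′ ++ [ w′ ]) ++ A₀) ++ [ w ]) ++ [ m ]
      target = cong (_++ [ m ]) (trans (cong ((A₀′ ++ [ w′ ]) ++_)
                 (trans (unfold-reverse w (reverse A₀)) (cong (_++ [ w ]) (reverse-involutive A₀))))
                 (sym (++-assoc (A₀′ ++ [ w′ ]) A₀ [ w ])))
      r₂ : Reversals π′ _ ((((A₀′ ++ [ w′ ]) ++ A₀) ++ [ w ]) ++ [ m ])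
      r₂ = subst (Reversals π′ _) target
             (proj₂ (move-to-end A₀′ w′ m (w ∷ reverse A₀) (s≤s z≤n) (bounded v′) (m-not-pinnacle v′) (non-pinnacle≤m v′) m<w′))

    move-max-to-end′ : ∀ A N → 2 ≤ length (A ++ m ∷ N) → Valid (A ++ m ∷ N) → MovedToEnd (A ++ m ∷ N)
    move-max-to-end′ A [] 2≤ v with reverseView A
    ... | []          = ⊥-elim (<-irrefl refl 2≤)
    ... | A₀ ∶ _ ∶ʳ w = moved A₀ w [] done (inj₁ z≤n)
    move-max-to-end′ A (b ∷ N) 2≤ v with reverseView A
    ... | [] = moved-∷ʳ (reverse (b ∷ N)) _ (subst (1 ≤_) (sym (length-reverse (b ∷ N))) (s≤s z≤n))
                 (subst (Reversals _ _) (unfold-reverse m (b ∷ N)) (proj₂ (reverse-all (m ∷ b ∷ N) (s≤s (s≤s z≤n)) (bounded v))))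
                 ≤-refl
    ... | A₀ ∶ _ ∶ʳ w with <-cmp m w
    ...   | tri< m<w _ _ = moved-∷ʳ ((A₀ ++ [ w ]) ++ reverse (b ∷ N)) _
                             (subst (1 ≤_) (sym (length-++ (A₀ ++ [ w ]))) (≤-trans (1≤length-∷ʳ A₀ w) (m≤m+n _ _)))
                             (proj₂ (move-to-end A₀ w m (b ∷ N) (s≤s z≤n) (bounded v) (m-not-pinnacle v) (non-pinnacle≤m v) m<w))
                             ≤-refl
    ...   | tri≈ _ refl _ = ⊥-elim (proj₂ (proj₂ (Unique-++⁻ (A₀ ++ [ w ]) (w ∷ b ∷ N) (proj₁ (proj₁ v))))
                                     (∈-++⁺ʳ A₀ (here refl) , here refl))
    ...   | tri> _ _ w<m = reverse-then-move A₀ w (b ∷ N) (s≤s z≤n) w<m v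

    move-max-to-end : ∀ π → 2 ≤ length π → Valid π → MovedToEnd π
    move-max-to-end π 2≤ v with ∈-∃++ (m∈ v)
    ... | A , N , refl = move-max-to-end′ A N 2≤ v

    reverse-to-non-pinnacle : ∀ X u w Y y → let σ = ((X ++ u ∷ w ∷ Y) ++ [ y ]) ++ [ m ] in
      Valid σ → u ∈ C′ ++ [ m ] → w ∈ C′ ++ [ m ] → m < y →
      OneReversal σ ((((X ++ [ u ]) ++ y ∷ reverse Y) ++ [ w ]) ++ [ m ])
    reverse-to-non-pinnacle X u w Y y v u∈C w∈C m<y =
      subst₂ OneReversal (sym σ≡) reversed
        (reverse-after-non-pinnacle X u w Y y m (bounded v′)
          (proj₂ (C⊆nonPinnacles (proj₂ v′) u∈C)) (proj₂ (C⊆nonPinnacles (proj₂ v′) w∈C)) (≤m u∈C) (≤m w∈C) m<y)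
      where
      σ≡ : ((X ++ u ∷ w ∷ Y) ++ [ y ]) ++ [ m ] ≡ (X ++ [ u ]) ++ (w ∷ Y ++ [ y ]) ++ [ m ]
      σ≡ = begin
          ((X ++ u ∷ w ∷ Y) ++ [ y ]) ++ [ m ]
        ≡⟨ cong (λ z → (z ++ [ y ]) ++ [ m ]) (sym (++-assoc X [ u ] (w ∷ Y))) ⟩
          (((X ++ [ u ]) ++ w ∷ Y) ++ [ y ]) ++ [ m ]
        ≡⟨ cong (_++ [ m ]) (++-assoc (X ++ [ u ]) (w ∷ Y) [ y ]) ⟩
          ((X ++ [ u ]) ++ (w ∷ Y ++ [ y ])) ++ [ m ]
        ≡⟨ ++-assoc (X ++ [ u ]) (w ∷ Y ++ [ y ]) [ m ] ⟩
          (X ++ [ u ]) ++ (w ∷ Y ++ [ y ]) ++ [ m ]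
        ∎
        where open ≡-Reasoning
      reversed : (X ++ [ u ]) ++ reverse (w ∷ Y ++ [ y ]) ++ [ m ] ≡ (((X ++ [ u ]) ++ y ∷ reverse Y) ++ [ w ]) ++ [ m ]
      reversed = begin
          (X ++ [ u ]) ++ reverse (w ∷ Y ++ [ y ]) ++ [ m ]
        ≡⟨ cong (λ z → (X ++ [ u ]) ++ z ++ [ m ]) (reverse-∷-∷ʳ w Y y) ⟩
          (X ++ [ u ]) ++ (y ∷ reverse Y ++ [ w ]) ++ [ m ]
        ≡⟨ sym (++-assoc (X ++ [ u ]) (y ∷ reverse Y ++ [ w ]) [ m ]) ⟩
          ((X ++ [ u ]) ++ (y ∷ reverse Y ++ [ w ])) ++ [ m ]
        ≡⟨ cong (_++ [ m ]) (sym (++-assoc (X ++ [ u ]) (y ∷ reverse Y) [ w ])) ⟩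
          (((X ++ [ u ]) ++ y ∷ reverse Y) ++ [ w ]) ++ [ m ]
        ∎
        where open ≡-Reasoning
      v′ : Valid ((X ++ [ u ]) ++ (w ∷ Y ++ [ y ]) ++ [ m ])
      v′ = subst Valid σ≡ v

    sort-via-consecutive : ∀ X u w Y y → let σ = ((X ++ u ∷ w ∷ Y) ++ [ y ]) ++ [ m ] in
      Valid σ → u ∈ C′ ++ [ m ] → w ∈ C′ ++ [ m ] → m < y → Below (length σ) →
      SortingWithin (suc (2 * length ((X ++ u ∷ w ∷ Y) ++ [ y ]))) σ (C′ ++ [ m ]) S
    sort-via-consecutive X u w Y y v u∈C w∈C m<y below =
      subst (λ k → SortingWithin (suc (2 * k)) σ (C′ ++ [ m ]) S) |τ₂w| (Reversals-then-sorting r sorted)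
      where
      σ τ₂ : List ℕ
      σ  = ((X ++ u ∷ w ∷ Y) ++ [ y ]) ++ [ m ]
      τ₂ = (X ++ [ u ]) ++ y ∷ reverse Y
      r : Reversals σ _ ((τ₂ ++ [ w ]) ++ [ m ])
      r = proj₂ (reverse-to-non-pinnacle X u w Y y v u∈C w∈C m<y)
      v₂ : Valid ((τ₂ ++ [ w ]) ++ [ m ])
      v₂ = Valid-Reversals r v
      |τ₂w| : length (τ₂ ++ [ w ]) ≡ length ((X ++ u ∷ w ∷ Y) ++ [ y ])
      |τ₂w| = suc-injective (begin
          suc (length (τ₂ ++ [ w ]))                ≡⟨ sym (length-∷ʳ (τ₂ ++ [ w ]) m) ⟩
          length ((τ₂ ++ [ w ]) ++ [ m ])           ≡⟨ sym (↭-length (Reversals-↭ r)) ⟩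
          length σ                                 ≡⟨ length-∷ʳ ((X ++ u ∷ w ∷ Y) ++ [ y ]) m ⟩
          suc (length ((X ++ u ∷ w ∷ Y) ++ [ y ])) ∎)
        where open ≡-Reasoning
      w≢m : w ≢ m
      w≢m w≡m = proj₂ (proj₂ (Unique-++⁻ (τ₂ ++ [ w ]) [ m ] (proj₁ (proj₁ v₂)))) (∈-++⁺ʳ τ₂ (here refl) , here w≡m)
      |τ₂w|<|σ| : length (τ₂ ++ [ w ]) < length σ
      |τ₂w|<|σ| = subst₂ _<_ (sym |τ₂w|) (sym (length-∷ʳ ((X ++ u ∷ w ∷ Y) ++ [ y ]) m)) ≤-refl
      sorted : SortingWithin (2 * length (τ₂ ++ [ w ])) ((τ₂ ++ [ w ]) ++ [ m ]) (C′ ++ [ m ]) S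
      sorted = sort-∷ʳ-max τ₂ w m C′ S (below _ |τ₂w|<|σ|) (proj₁ v₂) (proj₂ v₂) <C <S (≤∧≢⇒< (≤m w∈C) w≢m)

    sort-pair : ∀ τ S′ p → S ≡ S′ ++ [ p ] → 1 ≤ length τ → Valid (τ ++ p ∷ m ∷ []) → m < p →
      length (C′ ++ [ m ]) ≤ suc (length S) → Sortable τ →
      SortingWithin (suc (2 * length τ)) (τ ++ p ∷ m ∷ []) (C′ ++ [ m ]) S
    sort-pair τ S′ p S≡ ne (wf , sp) m<p few sortable =
      subst (SortingWithin (suc (2 * length τ)) (τ ++ p ∷ m ∷ []) (C′ ++ [ m ])) (sym S≡)
        (sort-++-pinnacle-max τ p m C′ S′ sortable ne wf (subst (PinnacleSplit _ _) S≡ sp) <C (subst (AllPairs _<_) S≡ <S) m<p few′)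
      where
      few′ : length C′ ≤ suc (length S′)
      few′ = ≤-pred (subst₂ (λ a b → a ≤ suc b) (length-∷ʳ C′ m) (trans (cong length S≡) (length-∷ʳ S′ p)) few)

    length-τ₀<σ : ∀ τ₀ y → length τ₀ < length ((τ₀ ++ [ y ]) ++ [ m ])
    length-τ₀<σ τ₀ y = subst (length τ₀ <_) (sym (trans (length-∷ʳ (τ₀ ++ [ y ]) m) (cong suc (length-∷ʳ τ₀ y))))
                         (m<n⇒m<1+n (n<1+n (length τ₀)))

    pinnacle-before-max : ∀ τ₀ y S′ → S ≡ S′ ++ [ y ] → let σ = (τ₀ ++ [ y ]) ++ [ m ] in
      Valid σ → m < y → length (C′ ++ [ m ]) ≤ suc (length S) → Below (length σ) →
      SortingWithin (suc (2 * length (τ₀ ++ [ y ]))) σ (C′ ++ [ m ]) S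
    pinnacle-before-max [] y S′ S≡ v m<y few below =
      ⊥-elim (first-not-pinnacle y [ m ] (proj₁ (bounded v y (here refl))) (proj₂ pin-y))
      where
      pin-y : Pinnacle (y ∷ m ∷ []) y
      pin-y = S⊆pinnacles (proj₂ v) (subst (y ∈_) (sym S≡) (∈-++⁺ʳ S′ (here refl)))
    pinnacle-before-max τ₀@(_ ∷ _) y S′ S≡ v m<y few below =
      SortingWithin-mono budget≤ (subst (λ π → SortingWithin (suc (2 * length τ₀)) π (C′ ++ [ m ]) S) (sym σ≡)
        (sort-pair τ₀ S′ y S≡ (s≤s z≤n) (subst Valid σ≡ v) m<y few (below τ₀ (length-τ₀<σ τ₀ y))))
      where
      σ≡ : (τ₀ ++ [ y ]) ++ [ m ] ≡ τ₀ ++ y ∷ m ∷ []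
      σ≡ = ++-assoc τ₀ [ y ] [ m ]
      budget≤ : suc (2 * length τ₀) ≤ suc (2 * length (τ₀ ++ [ y ]))
      budget≤ = s≤s (*-monoʳ-≤ 2 (subst (length τ₀ ≤_) (sym (length-∷ʳ τ₀ y)) (n≤1+n _)))

    pinnacle-inside : ∀ X p Z y S′ → S ≡ S′ ++ [ p ] → let σ = ((X ++ p ∷ Z) ++ [ y ]) ++ [ m ] in
      Valid σ → m < y → y ≤ p → length (C′ ++ [ m ]) ≤ suc (length S) → Below (length σ) →
      SortingWithin (suc (2 * length ((X ++ p ∷ Z) ++ [ y ]))) σ (C′ ++ [ m ]) S
    pinnacle-inside X p Z y S′ S≡ v m<y y≤p few below =
      SortingWithin-mono budget≤ (subst (λ π → SortingWithin _ π (C′ ++ [ m ]) S) (sym σ≡) (Reversals-then-sorting r sorted))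
      where
      τ″ σ′ : List ℕ
      τ″ = X ++ y ∷ reverse Z
      σ′ = X ++ (p ∷ Z ++ [ y ]) ++ [ m ]
      σ≡ : ((X ++ p ∷ Z) ++ [ y ]) ++ [ m ] ≡ σ′
      σ≡ = trans (cong (_++ [ m ]) (++-assoc X (p ∷ Z) [ y ])) (++-assoc X (p ∷ Z ++ [ y ]) [ m ])
      v′ : Valid σ′
      v′ = subst Valid σ≡ v
      pin-p : Pinnacle σ′ p
      pin-p = S⊆pinnacles (proj₂ v′) (subst (p ∈_) (sym S≡) (∈-++⁺ʳ S′ (here refl)))
      reversed : X ++ reverse (p ∷ Z ++ [ y ]) ++ [ m ] ≡ τ″ ++ p ∷ m ∷ []
      reversed = trans (cong (λ z → X ++ z ++ [ m ]) (reverse-∷-∷ʳ p Z y))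
                   (trans (cong (X ++_) (++-assoc (y ∷ reverse Z) [ p ] [ m ])) (sym (++-assoc X (y ∷ reverse Z) (p ∷ m ∷ []))))
      r : Reversals σ′ _ (τ″ ++ p ∷ m ∷ [])
      r = subst (Reversals σ′ _) reversed
            (proj₂ (reverse-from-max-pinnacle X p Z y m (bounded v′) pin-p (non-pinnacle≤m v′) m<y y≤p))
      |τ″| : length τ″ ≡ length (X ++ p ∷ Z)
      |τ″| = trans (length-++ X) (trans (cong (λ k → length X + suc k) (length-reverse Z)) (sym (length-++ X)))
      sorted : SortingWithin (suc (2 * length τ″)) (τ″ ++ p ∷ m ∷ []) (C′ ++ [ m ]) S
      sorted = sort-pair τ″ S′ p S≡ (subst (1 ≤_) (sym (length-++-sucʳ X y (reverse Z))) (s≤s z≤n))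
                 (Valid-Reversals r v′) (<-≤-trans m<y y≤p) few (below τ″ (subst (_< length (((X ++ p ∷ Z) ++ [ y ]) ++ [ m ])) (sym |τ″|) (length-τ₀<σ (X ++ p ∷ Z) y)))
      budget≤ : 1 + suc (2 * length τ″) ≤ suc (2 * length ((X ++ p ∷ Z) ++ [ y ]))
      budget≤ rewrite |τ″| | length-∷ʳ (X ++ p ∷ Z) y | *-suc 2 (length (X ++ p ∷ Z)) = s≤s (n≤1+n _)

    sort-via-max-pinnacle : ∀ τ₀ y S′ p → S ≡ S′ ++ [ p ] → let σ = (τ₀ ++ [ y ]) ++ [ m ] in
      Valid σ → m < y → y ≤ p → length (C′ ++ [ m ]) ≤ suc (length S) → Below (length σ) →
      SortingWithin (suc (2 * length (τ₀ ++ [ y ]))) σ (C′ ++ [ m ]) S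
    sort-via-max-pinnacle τ₀ y S′ p S≡ v m<y y≤p few below
      with ∈-++⁻ (τ₀ ++ [ y ]) (proj₁ (S⊆pinnacles (proj₂ v) (subst (p ∈_) (sym S≡) (∈-++⁺ʳ S′ (here refl)))))
    ... | inj₂ (here refl) = ⊥-elim (<-irrefl refl (<-≤-trans m<y y≤p))
    ... | inj₁ p∈τ with ∈-++⁻ τ₀ p∈τ
    ...   | inj₂ (here refl) = pinnacle-before-max τ₀ y S′ S≡ v m<y few below
    ...   | inj₁ p∈τ₀ with ∈-∃++ p∈τ₀
    ...     | X , Z , refl = pinnacle-inside X p Z y S′ S≡ v m<y y≤p few below

    above-max∈S : ∀ {π y} → Valid π → y ∈ π → m < y → y ∈ S
    above-max∈S {y = y} (_ , sp) y∈π m<y with y ∈? S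
    ... | yes y∈S = y∈S
    ... | no y∉S  = ⊥-elim (<⇒≱ m<y (≤m (nonPinnacles⊆C sp y∈π λ pin → y∉S (pinnacles⊆S sp pin))))

    -- Otherwise the letters of C alternate with those of S in τ₀ ++ y ∷ m ∷ [], as y ∈ S.
    few-non-pinnacles-consecutive : ∀ τ₀ y → Valid ((τ₀ ++ [ y ]) ++ [ m ]) → m < y →
      suc (suc (length S)) ≤ length (C′ ++ [ m ]) → ¬ NoConsecutive (C′ ++ [ m ]) τ₀
    few-non-pinnacles-consecutive τ₀ y v m<y many none = <⇒≱ many
      (NoConsecutive⇒length≤ C σ S (NoConsecutive-++-∷-∷ C τ₀ m y∉C none) (proj₁ (proj₁ v′))
        (AllPairs.map <⇒≢ <C) (AllPairs.map <⇒≢ <S)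
        (λ i → proj₁ (C⊆nonPinnacles sp i)) (λ i → proj₁ (S⊆pinnacles sp i)) σ⊆C∪S
        (λ s c → proj₂ (C⊆nonPinnacles sp c) (S⊆pinnacles sp s)))
      where
      C σ : List ℕ
      C = C′ ++ [ m ]
      σ = τ₀ ++ y ∷ m ∷ []
      v′ : Valid σ
      v′ = subst Valid (++-assoc τ₀ [ y ] [ m ]) v
      sp : PinnacleSplit σ C S
      sp = proj₂ v′
      y∉C : y ∉ C
      y∉C c = <⇒≱ m<y (≤m c)
      σ⊆C∪S : ∀ {v} → v ∈ σ → v ∉ C → v ∈ S
      σ⊆C∪S {v} i v∉C with v ∈? S
      ... | yes v∈S = v∈S
      ... | no v∉S  = ⊥-elim (v∉C (nonPinnacles⊆C sp i λ pin → v∉S (pinnacles⊆S sp pin)))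

    sort-pinnacle-last : ∀ τ₀ y → let σ = (τ₀ ++ [ y ]) ++ [ m ] in Valid σ → m < y → Below (length σ) →
      SortingWithin (suc (2 * length (τ₀ ++ [ y ]))) σ (C′ ++ [ m ]) S
    sort-pinnacle-last τ₀ y v m<y below with suc (suc (length S)) ≤? length (C′ ++ [ m ])
    ... | no few with ∷ʳ-view S (∈⇒1≤length (above-max∈S v (∈-++⁺ˡ (∈-++⁺ʳ τ₀ (here refl))) m<y))
    ...   | S′ , p , S≡ = sort-via-max-pinnacle τ₀ y S′ p S≡ v m<y y≤p (≤-pred (≰⇒> few)) below
      where
      y≤p : y ≤ p
      y≤p with ∈-++⁻ S′ (subst (y ∈_) S≡ (above-max∈S v (∈-++⁺ˡ (∈-++⁺ʳ τ₀ (here refl))) m<y))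
      ... | inj₁ i         = <⇒≤ (proj₂ (proj₂ (AllPairs-++⁻ S′ [ p ] (subst (AllPairs _<_) S≡ <S))) i (here refl))
      ... | inj₂ (here refl) = ≤-refl
    sort-pinnacle-last τ₀ y v m<y below | yes many with consecutive-or-none (C′ ++ [ m ]) τ₀
    ... | inj₁ (X , Y , u , w , refl , u∈C , w∈C) = sort-via-consecutive X u w Y y v u∈C w∈C m<y below
    ... | inj₂ none = ⊥-elim (few-non-pinnacles-consecutive τ₀ y v m<y many none)

    cost-≤2 : ∀ {k y} → k ≤ 1 ⊎ (k ≤ 2 × y < m) → k ≤ 2
    cost-≤2 (inj₁ k≤1)      = m≤n⇒m≤1+n k≤1
    cost-≤2 (inj₂ (k≤2 , _)) = k≤2

    cost-≤1 : ∀ {k y} → m < y → k ≤ 1 ⊎ (k ≤ 2 × y < m) → k ≤ 1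
    cost-≤1 m<y (inj₁ k≤1)      = k≤1
    cost-≤1 m<y (inj₂ (_ , y<m)) = ⊥-elim (<-asym y<m m<y)

    sort-moved : ∀ {π} → Valid π → Below (length π) → MovedToEnd π → SortingWithin (2 * length π) π (C′ ++ [ m ]) S
    sort-moved {π} v below (moved τ₀ y Rs r cost) with <-cmp y m
    ... | tri< y<m _ _ =
      SortingWithin-mono (subst (length Rs + 2 * length τ ≤_) (sym 2|π|) (+-monoˡ-≤ _ Rs≤2))
        (Reversals-then-sorting r (sort-∷ʳ-max τ₀ y m C′ S (below τ |τ|<|π|) (proj₁ v′) (proj₂ v′) <C <S y<m))
      where
      τ : List ℕ
      τ = τ₀ ++ [ y ]
      v′ : Valid (τ ++ [ m ])
      v′ = Valid-Reversals r v
      |π| : length π ≡ suc (length τ)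
      |π| = trans (↭-length (Reversals-↭ r)) (length-∷ʳ τ m)
      2|π| : 2 * length π ≡ 2 + 2 * length τ
      2|π| = trans (cong (2 *_) |π|) (*-suc 2 (length τ))
      |τ|<|π| : length τ < length π
      |τ|<|π| = subst (length τ <_) (sym |π|) (n<1+n _)
      Rs≤2 : length Rs ≤ 2
      Rs≤2 = cost-≤2 cost
    ... | tri≈ _ refl _ =
      ⊥-elim (proj₂ (proj₂ (Unique-++⁻ (τ₀ ++ [ y ]) [ y ] (proj₁ (proj₁ (Valid-Reversals r v))))) (∈-++⁺ʳ τ₀ (here refl) , here refl))
    ... | tri> _ _ m<y =
      SortingWithin-mono (subst (length Rs + suc (2 * length τ) ≤_) (sym 2|π|) (+-monoˡ-≤ _ Rs≤1))
        (Reversals-then-sorting r (sort-pinnacle-last τ₀ y (Valid-Reversals r v) m<y (subst Below |π|≡|σ| below)))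
      where
      τ : List ℕ
      τ = τ₀ ++ [ y ]
      |π|≡|σ| : length π ≡ length (τ ++ [ m ])
      |π|≡|σ| = ↭-length (Reversals-↭ r)
      2|π| : 2 * length π ≡ 2 + 2 * length τ
      2|π| = trans (cong (2 *_) (trans |π|≡|σ| (length-∷ʳ τ m))) (*-suc 2 (length τ))
      Rs≤1 : length Rs ≤ 1
      Rs≤1 = cost-≤1 m<y cost

  sortable-singleton : ∀ a → Sortable [ a ]
  sortable-singleton a C (s ∷ S) (_ , bd) _ _ _ sp with S⊆pinnacles sp (here refl)
  ... | here refl , lm = ⊥-elim (first-not-pinnacle a [] (proj₁ (bd a (here refl))) lm)
  sortable-singleton a [] [] (_ , bd) _ _ _ sp
    with () ← nonPinnacles⊆C sp (here refl) (λ pin → first-not-pinnacle a [] (proj₁ (bd a (here refl))) (proj₂ pin))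
  sortable-singleton a (c ∷ []) [] _ _ _ _ sp with proj₁ (C⊆nonPinnacles sp (here refl))
  ... | here refl = sorting [] done ≤-refl
  sortable-singleton a (c ∷ c′ ∷ C) [] _ _ ((c<c′ ∷ _) ∷ _) _ sp
    with proj₁ (C⊆nonPinnacles sp (here refl)) | proj₁ (C⊆nonPinnacles sp (there (here refl)))
  ... | here refl | here refl = ⊥-elim (<-irrefl refl c<c′)

  sortable-step : ∀ π → Below (length π) → Sortable π
  sortable-step (a ∷ []) _ = sortable-singleton a
  sortable-step π@(a ∷ b ∷ π′) below C S v ne <C <S sp with ∷ʳ-view C (∈⇒1≤length a∈C)
    where
    a∈C : a ∈ C
    a∈C = nonPinnacles⊆C sp (here refl) λ pin → first-not-pinnacle a (b ∷ π′) (proj₁ (proj₂ v a (here refl))) (proj₂ pin)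
  ... | C′ , m , refl = sort-moved (v , sp) below (move-max-to-end π (s≤s (s≤s z≤n)) (v , sp))
    where open MaximalNonPinnacle C′ m S <C <S

  below : ∀ n → Below n
  below zero    τ ()
  below (suc n) τ |τ|≤n = sortable-step τ λ τ′ lt → below n τ′ (≤-trans lt (≤-pred |τ|≤n))

  sortable : ∀ π → Sortable π
  sortable π = below (suc (length π)) π ≤-refl

rev-segment : ∀ (A M B : List ℕ) → rev (suc (length A)) (length A + length M) (A ++ M ++ B) ≡ A ++ reverse M ++ B
rev-segment A M B
  rewrite take-length-++ A (M ++ B) | drop-length-++ A (M ++ B) | m+n∸m≡n (length A) (length M)
        | take-length-++ M B | drop-length-++-++ A M B = refl

∈-init : ∀ (ρ : List ℕ) {R} zs {v c} ys → ρ ++ [ R ] ≡ zs ++ v ∷ c ∷ ys → v ∈ ρ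
∈-init []      []           _ ()
∈-init []      (_ ∷ [])     _ ()
∈-init []      (_ ∷ _ ∷ _)  _ ()
∈-init (r ∷ ρ) []           ys eq = here (sym (proj₁ (∷-injective eq)))
∈-init (r ∷ ρ) (_ ∷ zs)     ys eq = there (∈-init ρ zs ys (proj₂ (∷-injective eq)))

∈-inner : ∀ {L} (ρ : List ℕ) {R} xs {a v c} ys → L ∷ ρ ++ [ R ] ≡ xs ++ a ∷ v ∷ c ∷ ys → v ∈ ρ
∈-inner ρ []       ys eq = ∈-init ρ [] ys (proj₂ (∷-injective eq))
∈-inner ρ (x ∷ xs) {a} ys eq = ∈-init ρ (xs ++ [ a ]) ys (trans (proj₂ (∷-injective eq)) (sym (++-assoc xs [ a ] _)))

module Permutations (n : ℕ) where
  L R : ℕ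
  L = suc n
  R = suc (suc n)

  open Sentinels L R
  open Sorting L R (λ L≡R → <-irrefl L≡R (n<1+n L)) public

  range-unique : Unique (range n)
  range-unique = Unique.map⁺ suc-injective (Unique.upTo⁺ n)

  range-increasing : AllPairs _<_ (range n)
  range-increasing = AllPairs.map⁺ (AllPairs.map s≤s (AllPairs.applyUpTo⁺₁ (λ i → i) n (λ i<j _ → i<j)))

  range-bounded : Bounded (range n)
  range-bounded v i with ∈-map⁻ suc i
  ... | j , j∈ , refl = s≤s (∈-upTo⁻ j∈) , s≤s (≤-trans (∈-upTo⁻ j∈) (n≤1+n n))

  module _ {π : List ℕ} (π↭ : π ↭ range n) where

    wellFormed : WellFormed π
    wellFormed = Unique-resp-↭ (↭-sym π↭) range-unique , λ v i → range-bounded v (∈-resp-↭ π↭ i)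

    length≡n : length π ≡ n
    length≡n = trans (↭-length π↭) (trans (length-map suc (upTo n)) (length-upTo n))

    ext≡W : ext π ≡ W π
    ext≡W rewrite length≡n = refl

    isPinnacle⇔pinnacle : ∀ v → IsPinnacle π v ⇔ Pinnacle π v
    isPinnacle⇔pinnacle v = mk⇔ to from
      where
      to : IsPinnacle π v → Pinnacle π v
      to (xs , ys , a , c , eq , a<v , c<v) = ∈-inner π xs ys eq′ , localMax
        where
        eq′ : W π ≡ xs ++ a ∷ v ∷ c ∷ ys
        eq′ = trans (sym ext≡W) eq
        localMax : LocalMax (W π) v
        localMax u adj with neighbours-unique xs a v c ys (subst Unique eq′ (Unique-W wellFormed)) (subst (λ w → Adjacent w v u) eq′ adj)
        ... | inj₁ refl = a<v
        ... | inj₂ refl = c<v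
      from : Pinnacle π v → IsPinnacle π v
      from (i , lm) with ∈-∃++ i
      ... | P , Q , refl = initOr L P , tailW Q , lastOr L P , headOr R Q , trans ext≡W W≡ ,
                           lm _ (adjacent-sym left) , lm _ right
        where
        W≡ : W (P ++ v ∷ Q) ≡ initOr L P ++ lastOr L P ∷ v ∷ headOr R Q ∷ tailW Q
        W≡ = W-split P [ v ] Q
        left : Adjacent (W (P ++ v ∷ Q)) (lastOr L P) v
        left = subst (λ w → Adjacent w (lastOr L P) v) (sym W≡) (adjacent-++ʳ (initOr L P) front)
        right : Adjacent (W (P ++ v ∷ Q)) v (headOr R Q)
        right = subst (λ w → Adjacent w v (headOr R Q)) (sym W≡) (adjacent-++ʳ (initOr L P) (later front))

  Reversals⇒Reaches : ∀ {π Rs σ} → π ↭ range n → Reversals π Rs σ → Reaches π Rs σ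
  Reversals⇒Reaches π↭ done = done
  Reversals⇒Reaches π↭ (step A M B 1≤M same r) =
    step (s≤s z≤n) a≤b b≤n balanced (subst (λ π → Reaches π _ _) (sym (rev-segment A M B)) (Reversals⇒Reaches π′↭ r))
    where
    π′↭ : A ++ reverse M ++ B ↭ range n
    π′↭ = ↭-trans (↭-sym (zoom A (↭-sym (↭-reverse M)))) π↭
    a≤b : suc (length A) ≤ length A + length M
    a≤b = subst (_≤ length A + length M) (+-comm (length A) 1) (+-monoʳ-≤ (length A) 1≤M)
    b≤n : length A + length M ≤ length (A ++ M ++ B)
    b≤n = subst (length A + length M ≤_) (sym (trans (length-++ A) (cong (length A +_) (length-++ M))))
            (+-monoʳ-≤ (length A) (m≤m+n (length M) (length B)))
    balanced : Balanced (A ++ M ++ B) (suc (length A)) (length A + length M)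
    balanced v = subst (λ σ → IsPinnacle (A ++ M ++ B) v ⇔ IsPinnacle σ v) (sym (rev-segment A M B))
                   (⇔-sym (isPinnacle⇔pinnacle π′↭ v) ⇔-∘ (same v ⇔-∘ isPinnacle⇔pinnacle π↭ v))

  canonical-split : ∀ {π} S → π ↭ range n → (∀ v → v ∈ S ⇔ IsPinnacle π v) →
                    PinnacleSplit π (filter (λ v → ¬? (v ∈? S)) (range n)) S
  canonical-split {π} S π↭ S⇔ = record
    { S⊆pinnacles    = λ {v} i → to (isPinnacle⇔pinnacle π↭ v) (to (S⇔ v) i)
    ; pinnacles⊆S    = pinnacle∈S
    ; C⊆nonPinnacles = λ i → let (j , v∉S) = ∈-filter⁻ ∉S? {xs = range n} i in
                             ∈-resp-↭ (↭-sym π↭) j , λ pin → v∉S (pinnacle∈S pin)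
    ; nonPinnacles⊆C = λ {v} i np → ∈-filter⁺ ∉S? (∈-resp-↭ π↭ i) λ v∈S → np (to (isPinnacle⇔pinnacle π↭ v) (to (S⇔ v) v∈S))
    }
    where
    open Equivalence using (to; from)
    ∉S? : ∀ v → Dec (v ∉ S)
    ∉S? v = ¬? (v ∈? S)
    pinnacle∈S : ∀ {v} → Pinnacle π v → v ∈ S
    pinnacle∈S {v} pin = from (S⇔ v) (from (isPinnacle⇔pinnacle π↭ v) pin)

reversal-bounds : ∀ k p N → k + p + 2 ≤ N → k ≤ N ∸ 1 × k ≤ N ∸ (p ⊓ 3)
reversal-bounds k p N k+p+2≤N =
  m+n≤o⇒m≤o∸n k (≤-trans (+-monoʳ-≤ k (≤-trans (s≤s z≤n) (m≤n+m 2 p))) (≤-trans (≤-reflexive (sym (+-assoc k p 2))) k+p+2≤N)) ,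
  m+n≤o⇒m≤o∸n k (≤-trans (+-monoʳ-≤ k (m⊓n≤m p 3)) (≤-trans (m≤m+n (k + p) 2) k+p+2≤N))

theorem1 : (n : ℕ) → 1 ≤ n → (π : List ℕ) → π ↭ range n →
    (S : List ℕ) → AllPairs _<_ S → (∀ v → v ∈ S ⇔ IsPinnacle π v) →
    Σ (List (ℕ × ℕ)) λ R → Reaches π R (canonical n S) ×
      ((length S ≡ 0 → length R ≤ 2 * n ∸ 1) ×
       (1 ≤ length S → length R ≤ 2 * n ∸ (length S ⊓ 3)))
theorem1 n 1≤n π π↭ S <S S⇔ = moves , Reversals⇒Reaches π↭ reaches , (λ _ → proj₁ bounds) , (λ _ → proj₂ bounds)
  where
  open Permutations n
  C : List ℕ
  C = filter (λ v → ¬? (v ∈? S)) (range n)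
  result : SortingWithin (2 * length π) π C S
  result = sortable π C S (wellFormed π↭) (subst (1 ≤_) (sym (length≡n π↭)) 1≤n) (AllPairs.filter⁺ _ range-increasing) <S
             (canonical-split S π↭ S⇔)
  open SortingWithin result
  bounds : length moves ≤ 2 * n ∸ 1 × length moves ≤ 2 * n ∸ (length S ⊓ 3)
  bounds = reversal-bounds (length moves) (length S) (2 * n) (subst (λ k → length moves + length S + 2 ≤ 2 * k) (length≡n π↭) budget)
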